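{- For integers $m,n\geq 2$, let $G(m,n)$ be the grid graph, i.e. the Cartesian product $P_m \,\square\, P_n$ of paths on $m$ and $n$ vertices. Then $\check s(G(m,n))=1$ if $m=n=2$; $\check s(G(m,n))=2$ if $\min\{m,n\}=2$ and $\max\{m,n\}\geq 3$; $\check s(G(m,n))=3$ if $m,n\geq 3$ and $mn$ is even; and $\check s(G(m,n))=5$ if $m,n\geq 3$ and $mn$ is odd.
   Context: For a proper edge coloring $\varphi$ of a graph $G$, the palette of a vertex $v$ is the set of colors on edges incident with $v$. The palette index $\check s(G)$ is the minimum number of distinct palettes over all proper edge colorings of $G$. Concretely, $G(m,n)$ has vertex set $\{v^{(i)}_j : 1\le i\le m, 1\le j\le n\}$ and edges $v^{(i)}_jv^{(i)}_{j+1}$ and $v^{(i)}_jv^{(i+1)}_j$. -}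

module Defs where

open import Data.Nat using (ℕ; suc; _≤_)
open import Data.Fin using (Fin; toℕ)
open import Data.Product using (Σ; ∃; _×_; _,_)
open import Data.Sum using (_⊎_)
open import Relation.Binary.PropositionalEquality using (_≡_; _≢_)
open import Function.Bundles using (_⇔_)

-- Vertices of the grid graph G(m,n) = P_m □ P_n : v^(i)_j ↦ (i , j)
Vertex : ℕ → ℕ → Set
Vertex m n = Fin m × Fin n

-- Oriented edge relation: each undirected edge {u,v} of G(m,n) is
-- represented by exactly one Step u v (v is right of / below u).
Step : {m n : ℕ} → Vertex m n → Vertex m n → Set
Step (i , j) (i' , j') =
  (i ≡ i' × toℕ j' ≡ suc (toℕ j)) ⊎ (j ≡ j' × toℕ i' ≡ suc (toℕ i))

Adj : {m n : ℕ} → Vertex m n → Vertex m n → Set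
Adj u v = Step u v ⊎ Step v u

-- An edge colouring with colours in ℕ: a colour for every edge
-- (given on the oriented representative).
EdgeColouring : ℕ → ℕ → Set
EdgeColouring m n = (u v : Vertex m n) → Step u v → ℕ

colourAt : {m n : ℕ} → EdgeColouring m n → {x y : Vertex m n} → Adj x y → ℕ
colourAt φ {x} {y} (Data.Sum.inj₁ s) = φ x y s
colourAt φ {x} {y} (Data.Sum.inj₂ s) = φ y x s

Proper : {m n : ℕ} → EdgeColouring m n → Set
Proper {m} {n} φ = (x y z : Vertex m n) (a : Adj x y) (b : Adj x z) →
  y ≢ z → colourAt φ a ≢ colourAt φ b

InPalette : {m n : ℕ} → EdgeColouring m n → Vertex m n → ℕ → Set
InPalette {m} {n} φ x c = Σ (Vertex m n) λ y → Σ (Adj x y) λ a → colourAt φ a ≡ c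

SamePalette : {m n : ℕ} → EdgeColouring m n → Vertex m n → Vertex m n → Set
SamePalette φ x y = (c : ℕ) → InPalette φ x c ⇔ InPalette φ y c

-- φ has at most k distinct palettes: the palettes can be labelled
-- injectively by Fin k (f x ≡ f y exactly when palettes coincide).
AtMostPalettes : {m n : ℕ} → EdgeColouring m n → ℕ → Set
AtMostPalettes {m} {n} φ k =
  Σ (Vertex m n → Fin k) λ f → (x y : Vertex m n) → (f x ≡ f y) ⇔ SamePalette φ x y

PaletteIndex : ℕ → ℕ → ℕ → Set
PaletteIndex m n k =
  (Σ (EdgeColouring m n) λ φ → Proper φ × AtMostPalettes φ k)
  × ((φ : EdgeColouring m n) → Proper φ → (k' : ℕ) → AtMostPalettes φ k' → k ≤ k')

module Submission where

-- Upper bounds are explicit colourings.  When m is even, horizontal edges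
-- alternate the colours 0,1 along each row and vertical edges receive colours
-- in {0,1,2,3} from a short formula ('EvenColouring'); corners, side vertices
-- and interior vertices then see the palettes {0,1}, {0,1,2}, {0,1,2,3}, so
-- three palettes suffice (two for 2 × n, one for 2 × 2).  For m, n odd a
-- similar formula ('OddColouring') uses five palettes.
--
-- Lower bounds.  A palette has as many colours as its vertex has neighbours,
-- so corners, sides and interior vertices never share palettes ('GridRegions'),
-- giving 2 resp. 3.  For m, n odd we use the handshake parity: for every
-- colour x the number of vertices whose palette contains x is even
-- ('Handshake').  If corners, sides and interior together used at most four
-- palettes, one region would be uniform in a way that makes some such count
-- odd ('AtLeastFive').  Transposition reduces odd × even to even × odd.

open import Defs
open import Data.Nat using (ℕ; _≤_; _*_; _⊓_; _⊔_)
open import Data.Nat.Divisibility using (_∣_)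
open import Data.Product using (_×_)
open import Relation.Binary.PropositionalEquality using (_≡_)
open import Relation.Nullary using (¬_)

open import Data.Nat as N using (zero; suc; _+_; _<_; _<?_; z≤n; s≤s)
open import Data.Nat.Properties as NP using ()
open import Data.Fin as F using (Fin; toℕ; fromℕ<)
import Data.Fin.Properties as FP
open import Data.Product using (Σ; _,_; proj₁; proj₂)
open import Data.Sum using (_⊎_; inj₁; inj₂)
open import Data.Empty using (⊥; ⊥-elim)
open import Data.Unit using (tt)
open import Data.Bool using (Bool; true; false; not; _∧_; _∨_; if_then_else_; T)
open import Data.Maybe using (Maybe; just; nothing)
open import Data.Maybe.Properties using (just-injective)
open import Data.List using (List; []; _∷_; length)
open import Data.List.Membership.Propositional using (_∈_; _∉_)
open import Data.List.Relation.Unary.Any using (here; there)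
open import Relation.Binary.PropositionalEquality using (refl; sym; trans; cong; cong₂; subst; subst₂; _≢_; ≢-sym; module ≡-Reasoning)
open import Relation.Nullary using (Dec; yes; no; does)
open import Function.Bundles using (_⇔_; mk⇔; module Equivalence)
open import Function using (_∘_; case_of_)
import Axiom.UniquenessOfIdentityProofs as UIP

module DistinctLists {A : Set} where
  data Distinct : List A → Set where
    []ᵘ : Distinct []
    _∷ᵘ_ : ∀ {x xs} → x ∉ xs → Distinct xs → Distinct (x ∷ xs)

  remove-one : (x : A) (ys : List A) → x ∈ ys →
    Σ (List A) λ ys' → (suc (length ys') ≡ length ys) × (∀ {z} → z ∈ ys → z ≢ x → z ∈ ys')
  remove-one x (y ∷ ys) (here refl) = ys , refl , λ { (here refl) ne → ⊥-elim (ne refl) ; (there p) _ → p }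
  remove-one x (y ∷ ys) (there p) with remove-one x ys p
  ... | ys' , e , f = y ∷ ys' , cong suc e , λ { (here refl) _ → here refl ; (there q) ne → there (f q ne) }

  distinct-length-≤ : (xs ys : List A) → Distinct xs → (∀ {z} → z ∈ xs → z ∈ ys) → length xs ≤ length ys
  distinct-length-≤ [] ys u sub = z≤n
  distinct-length-≤ (x ∷ xs) ys (nx ∷ᵘ u) sub with remove-one x ys (sub (here refl))
  ... | ys' , e , f = subst (suc (length xs) ≤_) e
        (s≤s (distinct-length-≤ xs ys' u (λ {z} zin → f (sub (there zin)) (λ { refl → nx zin }))))

  ∉-singleton : ∀ {x a : A} → x ≢ a → x ∉ (a ∷ [])
  ∉-singleton ne (here refl) = ne refl

  ∉-∷ : ∀ {x a : A} {l} → x ≢ a → x ∉ l → x ∉ (a ∷ l)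
  ∉-∷ ne nl (here refl) = ne refl
  ∉-∷ ne nl (there p) = nl p
open DistinctLists public

n≢1+n : ∀ {k} → k ≢ suc k
n≢1+n e = NP.1+n≢n (sym e)

2+n≢n : ∀ {k} → suc (suc k) ≢ k
2+n≢n {suc k} e = 2+n≢n (NP.suc-injective e)

-- Proofs of 'Step x y' are unique, so an edge colouring φ assigns one
-- well-defined colour to each edge regardless of how the edge is presented.
module StepFacts {m n : ℕ} where
  Fin-≡-irrelevant : ∀ {k} {a b : Fin k} (p q : a ≡ b) → p ≡ q
  Fin-≡-irrelevant = UIP.Decidable⇒UIP.≡-irrelevant FP._≟_

  Step-irrelevant : {x y : Vertex m n} (s s' : Step x y) → s ≡ s'
  Step-irrelevant (inj₁ (e , t)) (inj₁ (e' , t')) = cong₂ (λ a b → inj₁ (a , b)) (Fin-≡-irrelevant e e') (NP.≡-irrelevant t t')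
  Step-irrelevant (inj₂ (e , t)) (inj₂ (e' , t')) = cong₂ (λ a b → inj₂ (a , b)) (Fin-≡-irrelevant e e') (NP.≡-irrelevant t t')
  Step-irrelevant (inj₁ (e , t)) (inj₂ (e' , t')) = ⊥-elim (n≢1+n (trans (cong toℕ e') t))
  Step-irrelevant (inj₂ (e , t)) (inj₁ (e' , t')) = ⊥-elim (n≢1+n (trans (cong toℕ e) t'))

data Dir : Set where
  R L D U : Dir

Neighbour : Dir → ℕ → ℕ → ℕ → ℕ → Set
Neighbour R i j i' j' = i' ≡ i × j' ≡ suc j
Neighbour L i j i' j' = i' ≡ i × suc j' ≡ j
Neighbour D i j i' j' = i' ≡ suc i × j' ≡ j
Neighbour U i j i' j' = suc i' ≡ i × j' ≡ j

neighbour-unique : ∀ d {i j i1 j1 i2 j2} → Neighbour d i j i1 j1 → Neighbour d i j i2 j2 → i1 ≡ i2 × j1 ≡ j2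
neighbour-unique R (a , b) (c , e) = trans a (sym c) , trans b (sym e)
neighbour-unique L (a , b) (c , e) = trans a (sym c) , NP.suc-injective (trans b (sym e))
neighbour-unique D (a , b) (c , e) = trans a (sym c) , trans b (sym e)
neighbour-unique U (a , b) (c , e) = NP.suc-injective (trans a (sym c)) , trans b (sym e)

dirDec : (d d' : Dir) → (d ≡ d') ⊎ (d ≢ d')
dirDec R R = inj₁ refl
dirDec L L = inj₁ refl
dirDec D D = inj₁ refl
dirDec U U = inj₁ refl
dirDec R L = inj₂ λ ()
dirDec R D = inj₂ λ ()
dirDec R U = inj₂ λ ()
dirDec L R = inj₂ λ ()
dirDec L D = inj₂ λ ()
dirDec L U = inj₂ λ ()
dirDec D R = inj₂ λ ()
dirDec D L = inj₂ λ ()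
dirDec D U = inj₂ λ ()
dirDec U R = inj₂ λ ()
dirDec U L = inj₂ λ ()
dirDec U D = inj₂ λ ()

neighbour-direction-unique : ∀ d d' {i j i1 j1} → d ≢ d' → Neighbour d i j i1 j1 → Neighbour d' i j i1 j1 → ⊥
neighbour-direction-unique R R ne _ _ = ne refl
neighbour-direction-unique L L ne _ _ = ne refl
neighbour-direction-unique D D ne _ _ = ne refl
neighbour-direction-unique U U ne _ _ = ne refl
neighbour-direction-unique R L _ (a , b) (c , e) = 2+n≢n (trans (cong suc (sym b)) e)
neighbour-direction-unique R D _ (a , b) (c , e) = n≢1+n (trans (sym a) c)
neighbour-direction-unique R U _ (a , b) (c , e) = n≢1+n (trans (sym c) (cong suc a))
neighbour-direction-unique L R _ (a , b) (c , e) = 2+n≢n (trans (cong suc (sym e)) b)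
neighbour-direction-unique L D _ (a , b) (c , e) = n≢1+n (trans (sym a) c)
neighbour-direction-unique L U _ (a , b) (c , e) = n≢1+n (trans (sym c) (cong suc a))
neighbour-direction-unique D R _ (a , b) (c , e) = n≢1+n (trans (sym c) a)
neighbour-direction-unique D L _ (a , b) (c , e) = n≢1+n (trans (sym c) a)
neighbour-direction-unique D U _ (a , b) (c , e) = 2+n≢n (trans (cong suc (sym a)) c)
neighbour-direction-unique U R _ (a , b) (c , e) = n≢1+n (trans (sym a) (cong suc c))
neighbour-direction-unique U L _ (a , b) (c , e) = n≢1+n (trans (sym a) (cong suc c))
neighbour-direction-unique U D _ (a , b) (c , e) = 2+n≢n (trans (cong suc (sym c)) a)

-- Coordinate view of a colouring.  'hColour i j' is the colour of the edge
-- (i,j)–(i,j+1) and 'vColour i j' that of (i,j)–(i+1,j) (both 0 off the grid);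
-- 'port d i j' is the colour of the edge leaving (i,j) in direction d, if any.
module Ports {m n : ℕ} (φ : EdgeColouring m n) where
  open StepFacts {m} {n}

  private
    V : Set
    V = Vertex m n

  φ-cong : ∀ {x x' y y'} (s : Step x y) (s' : Step x' y') → x ≡ x' → y ≡ y' → φ x y s ≡ φ x' y' s'
  φ-cong s s' refl refl = cong (φ _ _) (Step-irrelevant s s')

  -- Opaque so that the colour of an edge is compared as a value, not unfolded.
  opaque
    hColour : ℕ → ℕ → ℕ
    hColour i j with i <? m | suc j <? n
    ... | yes p | yes q = φ (fromℕ< p , fromℕ< (NP.<-trans (NP.n<1+n j) q)) (fromℕ< p , fromℕ< q)
                            (inj₁ (refl , trans (FP.toℕ-fromℕ< q) (cong suc (sym (FP.toℕ-fromℕ< _)))))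
    ... | _ | _ = 0

    vColour : ℕ → ℕ → ℕ
    vColour i j with suc i <? m | j <? n
    ... | yes p | yes q = φ (fromℕ< (NP.<-trans (NP.n<1+n i) p) , fromℕ< q) (fromℕ< p , fromℕ< q)
                            (inj₂ (refl , trans (FP.toℕ-fromℕ< p) (cong suc (sym (FP.toℕ-fromℕ< _)))))
    ... | _ | _ = 0

    hColour-spec : (x y : V) (e : proj₁ x ≡ proj₁ y) (t : toℕ (proj₂ y) ≡ suc (toℕ (proj₂ x))) →
              φ x y (inj₁ (e , t)) ≡ hColour (toℕ (proj₁ x)) (toℕ (proj₂ x))
    hColour-spec (a , b) (a' , b') e t with toℕ a <? m | suc (toℕ b) <? n
    ... | yes p | yes q = φ-cong _ _ (cong₂ _,_ (sym (FP.fromℕ<-toℕ a p)) (sym (FP.fromℕ<-toℕ b _)))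
                            (cong₂ _,_ (trans (sym e) (sym (FP.fromℕ<-toℕ a p))) (FP.toℕ-injective (trans t (sym (FP.toℕ-fromℕ< q)))))
    ... | no np | _ = ⊥-elim (np (FP.toℕ<n a))
    ... | yes _ | no nq = ⊥-elim (nq (subst (_< n) t (FP.toℕ<n b')))

    vColour-spec : (x y : V) (e : proj₂ x ≡ proj₂ y) (t : toℕ (proj₁ y) ≡ suc (toℕ (proj₁ x))) →
              φ x y (inj₂ (e , t)) ≡ vColour (toℕ (proj₁ x)) (toℕ (proj₂ x))
    vColour-spec (a , b) (a' , b') e t with suc (toℕ a) <? m | toℕ b <? n
    ... | yes p | yes q = φ-cong _ _ (cong₂ _,_ (sym (FP.fromℕ<-toℕ a _)) (sym (FP.fromℕ<-toℕ b q)))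
                            (cong₂ _,_ (FP.toℕ-injective (trans t (sym (FP.toℕ-fromℕ< p)))) (trans (sym e) (sym (FP.fromℕ<-toℕ b q))))
    ... | _ | no nq = ⊥-elim (nq (FP.toℕ<n b))
    ... | no np | yes _ = ⊥-elim (np (subst (_< m) t (FP.toℕ<n a')))

  port : Dir → ℕ → ℕ → Maybe ℕ
  port R i j = if suc j N.<ᵇ n then just (hColour i j) else nothing
  port L i zero = nothing
  port L i (suc j) = just (hColour i j)
  port D i j = if suc i N.<ᵇ m then just (vColour i j) else nothing
  port U zero j = nothing
  port U (suc i) j = just (vColour i j)

  portR-yes : ∀ i j → suc j < n → port R i j ≡ just (hColour i j)
  portR-yes i j p with suc j N.<ᵇ n in eq
  ... | true = refl
  ... | false = ⊥-elim (subst T eq (NP.<⇒<ᵇ p))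

  portD-yes : ∀ i j → suc i < m → port D i j ≡ just (vColour i j)
  portD-yes i j p with suc i N.<ᵇ m in eq
  ... | true = refl
  ... | false = ⊥-elim (subst T eq (NP.<⇒<ᵇ p))

  portR-just : ∀ i j {c} → port R i j ≡ just c → suc j < n × hColour i j ≡ c
  portR-just i j e with suc j N.<ᵇ n in eq
  portR-just i j refl | true = NP.<ᵇ⇒< (suc j) n (subst T (sym eq) tt) , refl

  portD-just : ∀ i j {c} → port D i j ≡ just c → suc i < m × vColour i j ≡ c
  portD-just i j e with suc i N.<ᵇ m in eq
  portD-just i j refl | true = NP.<ᵇ⇒< (suc i) m (subst T (sym eq) tt) , refl

  portL-eq : ∀ i {j j'} → j ≡ suc j' → port L i j ≡ just (hColour i j')
  portL-eq i refl = refl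

  portU-eq : ∀ j {i i'} → i ≡ suc i' → port U i j ≡ just (vColour i' j)
  portU-eq j refl = refl

  adjacency⇒port : ∀ (x y : V) (ad : Adj x y) → Σ Dir λ d →
    (port d (toℕ (proj₁ x)) (toℕ (proj₂ x)) ≡ just (colourAt φ ad)) ×
    Neighbour d (toℕ (proj₁ x)) (toℕ (proj₂ x)) (toℕ (proj₁ y)) (toℕ (proj₂ y))
  adjacency⇒port (a , b) (a' , b') (inj₁ (inj₁ (e , t))) =
    R , trans (portR-yes (toℕ a) (toℕ b) (subst (_< n) t (FP.toℕ<n b'))) (cong just (sym (hColour-spec (a , b) (a' , b') e t))) , (cong toℕ (sym e) , t)
  adjacency⇒port (a , b) (a' , b') (inj₁ (inj₂ (e , t))) =
    D , trans (portD-yes (toℕ a) (toℕ b) (subst (_< m) t (FP.toℕ<n a'))) (cong just (sym (vColour-spec (a , b) (a' , b') e t))) , (t , cong toℕ (sym e))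
  adjacency⇒port (a , b) (a' , b') (inj₂ (inj₁ (e , t))) =
    L , trans (portL-eq (toℕ a) t) (cong just (trans (cong (λ z → hColour z (toℕ b')) (cong toℕ (sym e))) (sym (hColour-spec (a' , b') (a , b) e t)))) , (cong toℕ e , sym t)
  adjacency⇒port (a , b) (a' , b') (inj₂ (inj₂ (e , t))) =
    U , trans (portU-eq (toℕ b) t) (cong just (trans (cong (λ z → vColour (toℕ a') z) (cong toℕ (sym e))) (sym (vColour-spec (a' , b') (a , b) e t)))) , (sym t , cong toℕ e)

  left-port⇒adjacency : ∀ (a : Fin m) (b : Fin n) j {c} → toℕ b ≡ j → port L (toℕ a) j ≡ just c →
    Σ V λ y → Σ (Adj (a , b) y) λ ad → (colourAt φ ad ≡ c) × Neighbour L (toℕ a) (toℕ b) (toℕ (proj₁ y)) (toℕ (proj₂ y))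
  left-port⇒adjacency a b zero eqb ()
  left-port⇒adjacency a b (suc j) eqb e =
    let jn : j < n
        jn = NP.<-trans (NP.n<1+n j) (subst (_< n) eqb (FP.toℕ<n b))
        t : toℕ b ≡ suc (toℕ (fromℕ< jn))
        t = trans eqb (cong suc (sym (FP.toℕ-fromℕ< jn)))
    in (a , fromℕ< jn) , inj₂ (inj₁ (refl , t)) ,
       trans (hColour-spec (a , fromℕ< jn) (a , b) refl t) (trans (cong (hColour (toℕ a)) (FP.toℕ-fromℕ< jn)) (just-injective e)) ,
       (refl , trans (cong suc (FP.toℕ-fromℕ< jn)) (sym eqb))

  up-port⇒adjacency : ∀ (a : Fin m) (b : Fin n) i {c} → toℕ a ≡ i → port U i (toℕ b) ≡ just c →
    Σ V λ y → Σ (Adj (a , b) y) λ ad → (colourAt φ ad ≡ c) × Neighbour U (toℕ a) (toℕ b) (toℕ (proj₁ y)) (toℕ (proj₂ y))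
  up-port⇒adjacency a b zero eqa ()
  up-port⇒adjacency a b (suc i) eqa e =
    let im : i < m
        im = NP.<-trans (NP.n<1+n i) (subst (_< m) eqa (FP.toℕ<n a))
        t : toℕ a ≡ suc (toℕ (fromℕ< im))
        t = trans eqa (cong suc (sym (FP.toℕ-fromℕ< im)))
    in (fromℕ< im , b) , inj₂ (inj₂ (refl , t)) ,
       trans (vColour-spec (fromℕ< im , b) (a , b) refl t) (trans (cong (λ z → vColour z (toℕ b)) (FP.toℕ-fromℕ< im)) (just-injective e)) ,
       (trans (cong suc (FP.toℕ-fromℕ< im)) (sym eqa) , refl)

  port⇒adjacency : ∀ (a : Fin m) (b : Fin n) d {c} → port d (toℕ a) (toℕ b) ≡ just c →
    Σ V λ y → Σ (Adj (a , b) y) λ ad → (colourAt φ ad ≡ c) × Neighbour d (toℕ a) (toℕ b) (toℕ (proj₁ y)) (toℕ (proj₂ y))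
  port⇒adjacency a b R e with portR-just (toℕ a) (toℕ b) e
  ... | q , hc = (a , fromℕ< q) , inj₁ (inj₁ (refl , FP.toℕ-fromℕ< q)) ,
                 trans (hColour-spec (a , b) (a , fromℕ< q) refl (FP.toℕ-fromℕ< q)) hc , (refl , FP.toℕ-fromℕ< q)
  port⇒adjacency a b D e with portD-just (toℕ a) (toℕ b) e
  ... | q , hc = (fromℕ< q , b) , inj₁ (inj₂ (refl , FP.toℕ-fromℕ< q)) ,
                 trans (vColour-spec (a , b) (fromℕ< q , b) refl (FP.toℕ-fromℕ< q)) hc , (FP.toℕ-fromℕ< q , refl)
  port⇒adjacency a b L e = left-port⇒adjacency a b (toℕ b) refl e
  port⇒adjacency a b U e = up-port⇒adjacency a b (toℕ a) refl e

  HasPort : ℕ → ℕ → ℕ → Set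
  HasPort i j c = Σ Dir λ d → port d i j ≡ just c

  palette⇔ports : ∀ (x : V) c → InPalette φ x c ⇔ HasPort (toℕ (proj₁ x)) (toℕ (proj₂ x)) c
  palette⇔ports (a , b) c = mk⇔
    (λ { (y , ad , e) → let (d , p , _) = adjacency⇒port (a , b) y ad in d , trans p (cong just e) })
    (λ { (d , p) → let (y , ad , e , _) = port⇒adjacency a b d p in y , ad , e })

  PortsDistinct : Set
  PortsDistinct = ∀ (a : Fin m) (b : Fin n) d d' {c c'} → d ≢ d' →
       port d (toℕ a) (toℕ b) ≡ just c → port d' (toℕ a) (toℕ b) ≡ just c' → c ≢ c'

  proper⇒ports-distinct : Proper φ → PortsDistinct
  proper⇒ports-distinct pr a b d d' ne p p' eq =
    let (y , ay , ey , ny) = port⇒adjacency a b d p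
        (z , az , ez , nz) = port⇒adjacency a b d' p'
    in pr (a , b) y z ay az (λ yz → neighbour-direction-unique d d' ne ny (subst (λ w → Neighbour d' (toℕ a) (toℕ b) (toℕ (proj₁ w)) (toℕ (proj₂ w))) (sym yz) nz)) (trans ey (trans eq (sym ez)))

  ports-distinct⇒proper : PortsDistinct → Proper φ
  ports-distinct⇒proper ports-distinct (a , b) y z ay az ne eq with adjacency⇒port (a , b) y ay | adjacency⇒port (a , b) z az
  ... | d , p , ny | d' , p' , nz with dirDec d d'
  ... | inj₂ dd = ports-distinct a b d d' dd p p' eq
  ... | inj₁ refl = let (e1 , e2) = neighbour-unique d ny nz in ne (cong₂ _,_ (FP.toℕ-injective e1) (FP.toℕ-injective e2))

-- Colourings given by explicit formulas: H i j colours (i,j)–(i,j+1) and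
-- V i j colours (i,j)–(i+1,j).  'construction-correct' reduces properness and
-- the palette bound to facts about finitely many local situations: if every
-- position has a "profile" τ i j satisfying a constraint Cons, the ports of
-- (i,j) are determined by its profile ('cport'), ports of one profile are
-- distinct, and the palette of a profile is listed by 'pal' (through a label
-- 'code'), with distinct labels listing distinct sets, then the colouring is
-- proper with at most k palettes.
module Construction {m n : ℕ} (H V : ℕ → ℕ → ℕ) where
  φ : EdgeColouring m n
  φ x y (inj₁ _) = H (toℕ (proj₁ x)) (toℕ (proj₂ x))
  φ x y (inj₂ _) = V (toℕ (proj₁ x)) (toℕ (proj₂ x))
  open Ports φ

  portM : Dir → ℕ → ℕ → Maybe ℕ
  portM R i j = if suc j N.<ᵇ n then just (H i j) else nothing
  portM L i zero = nothing
  portM L i (suc j) = just (H i j)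
  portM D i j = if suc i N.<ᵇ m then just (V i j) else nothing
  portM U zero j = nothing
  portM U (suc i) j = just (V i j)

  HcH : ∀ i j → (p : i < m) → (q : suc j < n) → hColour i j ≡ H i j
  HcH i j p q =
    let q' = NP.<-trans (NP.n<1+n j) q
        t = trans (FP.toℕ-fromℕ< q) (cong suc (sym (FP.toℕ-fromℕ< q')))
    in trans (sym (cong₂ hColour (FP.toℕ-fromℕ< p) (FP.toℕ-fromℕ< q')))
        (trans (sym (hColour-spec (fromℕ< p , fromℕ< q') (fromℕ< p , fromℕ< q) refl t))
               (cong₂ H (FP.toℕ-fromℕ< p) (FP.toℕ-fromℕ< q')))

  VcV : ∀ i j → (p : suc i < m) → (q : j < n) → vColour i j ≡ V i j
  VcV i j p q =
    let p' = NP.<-trans (NP.n<1+n i) p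
        t = trans (FP.toℕ-fromℕ< p) (cong suc (sym (FP.toℕ-fromℕ< p')))
    in trans (sym (cong₂ vColour (FP.toℕ-fromℕ< p') (FP.toℕ-fromℕ< q)))
        (trans (sym (vColour-spec (fromℕ< p' , fromℕ< q) (fromℕ< p , fromℕ< q) refl t))
               (cong₂ V (FP.toℕ-fromℕ< p') (FP.toℕ-fromℕ< q)))

  portEq : ∀ d i j → i < m → j < n → port d i j ≡ portM d i j
  portEq R i j p q with suc j N.<ᵇ n in eq
  ... | true = cong just (HcH i j p (NP.<ᵇ⇒< (suc j) n (subst T (sym eq) tt)))
  ... | false = refl
  portEq L i zero p q = refl
  portEq L i (suc j) p q = cong just (HcH i j p q)
  portEq D i j p q with suc i N.<ᵇ m in eq
  ... | true = cong just (VcV i j (NP.<ᵇ⇒< (suc i) m (subst T (sym eq) tt)) q)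
  ... | false = refl
  portEq U zero j p q = refl
  portEq U (suc i) j p q = cong just (VcV i j p q)

  construction-correct : (Profile : Set) (τ : ℕ → ℕ → Profile) (cport : Dir → Profile → Maybe ℕ) (Cons : Profile → Set)
    (consOK : ∀ i j → i < m → j < n → Cons (τ i j))
    (portOK : ∀ d i j → i < m → j < n → portM d i j ≡ cport d (τ i j))
    (distOK : ∀ t → Cons t → ∀ d d' {c c'} → d ≢ d' → cport d t ≡ just c → cport d' t ≡ just c' → c ≢ c')
    {k : ℕ} (code : Profile → Fin k) (pal : Fin k → List ℕ)
    (palOK : ∀ t → Cons t → ∀ c → (Σ Dir λ d → cport d t ≡ just c) ⇔ (c ∈ pal (code t)))
    (palInj : ∀ ℓ ℓ' → (∀ c → c ∈ pal ℓ → c ∈ pal ℓ') → (∀ c → c ∈ pal ℓ' → c ∈ pal ℓ) → ℓ ≡ ℓ') →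
    Proper φ × AtMostPalettes φ k
  construction-correct Profile τ cport Cons consOK portOK distOK {k} code pal palOK palInj = pr , f , fOK
    where
    pe : ∀ (a : Fin m) (b : Fin n) d → port d (toℕ a) (toℕ b) ≡ cport d (τ (toℕ a) (toℕ b))
    pe a b d = trans (portEq d (toℕ a) (toℕ b) (FP.toℕ<n a) (FP.toℕ<n b)) (portOK d (toℕ a) (toℕ b) (FP.toℕ<n a) (FP.toℕ<n b))
    cs : ∀ (a : Fin m) (b : Fin n) → Cons (τ (toℕ a) (toℕ b))
    cs a b = consOK (toℕ a) (toℕ b) (FP.toℕ<n a) (FP.toℕ<n b)
    pr : Proper φ
    pr = ports-distinct⇒proper (λ a b d d' ne p p' → distOK _ (cs a b) d d' ne (trans (sym (pe a b d)) p) (trans (sym (pe a b d')) p'))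
    f : Vertex m n → Fin k
    f (a , b) = code (τ (toℕ a) (toℕ b))
    inPal : ∀ (x : Vertex m n) c → InPalette φ x c ⇔ (c ∈ pal (f x))
    inPal (a , b) c = mk⇔
      (λ ip → let (d , p) = Equivalence.to (palette⇔ports (a , b) c) ip in Equivalence.to (palOK _ (cs a b) c) (d , trans (sym (pe a b d)) p))
      (λ cin → let (d , p) = Equivalence.from (palOK _ (cs a b) c) cin in Equivalence.from (palette⇔ports (a , b) c) (d , trans (pe a b d) p))
    fOK : (x y : Vertex m n) → (f x ≡ f y) ⇔ SamePalette φ x y
    fOK x y = mk⇔
      (λ e c → mk⇔ (λ ix → Equivalence.from (inPal y c) (subst (λ ℓ → c ∈ pal ℓ) e (Equivalence.to (inPal x c) ix)))
                   (λ iy → Equivalence.from (inPal x c) (subst (λ ℓ → c ∈ pal ℓ) (sym e) (Equivalence.to (inPal y c) iy))))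
      (λ sp → palInj (f x) (f y)
         (λ c cx → Equivalence.to (inPal y c) (Equivalence.to (sp c) (Equivalence.from (inPal x c) cx)))
         (λ c cy → Equivalence.to (inPal x c) (Equivalence.from (sp c) (Equivalence.from (inPal y c) cy))))

-- Boolean bookkeeping for the constructions: the 'Profile' of a grid
-- position and exhaustive checks over all profiles, decided by evaluation.
module Profiles where
  open import Data.Vec using (Vec; []; _∷_)

  T∧₁ : ∀ {a b} → T (a ∧ b) → T a
  T∧₁ {true} h = tt
  T∧₂ : ∀ {a b} → T (a ∧ b) → T b
  T∧₂ {true} h = h

  splitB : ∀ a b → T (a ∧ b) → T a × T b
  splitB true b h = tt , h

  BoolFun : ℕ → Set
  BoolFun zero = Bool
  BoolFun (suc k) = Bool → BoolFun k

  allArgs : ∀ k → BoolFun k → Bool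
  allArgs zero b = b
  allArgs (suc k) f = allArgs k (f true) ∧ allArgs k (f false)

  applyArgs : ∀ k → BoolFun k → Vec Bool k → Bool
  applyArgs zero b [] = b
  applyArgs (suc k) f (b ∷ bs) = applyArgs k (f b) bs

  allArgs-sound : ∀ k f → T (allArgs k f) → ∀ bs → T (applyArgs k f bs)
  allArgs-sound zero b h [] = h
  allArgs-sound (suc k) f h (true ∷ bs) = allArgs-sound k (f true) (T∧₁ h) bs
  allArgs-sound (suc k) f h (false ∷ bs) = allArgs-sound k (f false) (T∧₂ h) bs

  -- The local features of position (i,j) that the colouring formulas read:
  -- u: i = 0,  dd: row i+1 exists,  lr: i is the last row,  sl: i is the
  -- second-to-last row,  ip: i odd,  z: j = 0,  rr: column j+1 exists,
  -- z1: j = 1,  jp: j odd.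
  data Profile : Set where
    profile : (u dd lr sl ip z rr z1 jp : Bool) → Profile

  allProfiles : (Profile → Bool) → Bool
  allProfiles P = allArgs 9 λ u dd lr sl ip z rr z1 jp → P (profile u dd lr sl ip z rr z1 jp)

  allProfiles-sound : ∀ {P} → T (allProfiles P) → ∀ t → T (P t)
  allProfiles-sound {P} h (profile u dd lr sl ip z rr z1 jp) =
    allArgs-sound 9 (λ u dd lr sl ip z rr z1 jp → P (profile u dd lr sl ip z rr z1 jp)) h
      (u ∷ dd ∷ lr ∷ sl ∷ ip ∷ z ∷ rr ∷ z1 ∷ jp ∷ [])

  odd : ℕ → Bool
  odd zero = false
  odd (suc k) = not (odd k)

  b2n : Bool → ℕ
  b2n true = 1
  b2n false = 0

  profileAt : (m n : ℕ) → ℕ → ℕ → Profile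
  profileAt m n i j = profile (i N.≡ᵇ 0) (suc i N.<ᵇ m) (suc i N.≡ᵇ m) (suc (suc i) N.≡ᵇ m) (odd i)
                    (j N.≡ᵇ 0) (suc j N.<ᵇ n) (j N.≡ᵇ 1) (odd j)

  neqM : Maybe ℕ → Maybe ℕ → Bool
  neqM (just a) (just b) = not (a N.≡ᵇ b)
  neqM _ _ = true

  distB : (Dir → Maybe ℕ) → Bool
  distB P = neqM (P R) (P L) ∧ neqM (P R) (P D) ∧ neqM (P R) (P U) ∧
            neqM (P L) (P D) ∧ neqM (P L) (P U) ∧ neqM (P D) (P U)

  neqM-sound : ∀ {p q c c'} → T (neqM p q) → p ≡ just c → q ≡ just c' → c ≢ c'
  neqM-sound {just a} {just b} h refl refl refl with a N.≡ᵇ a in eq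
  ... | true = h
  ... | false = subst T eq (NP.≡⇒≡ᵇ a a refl)

  neqM-sym : ∀ {p q c c'} → T (neqM p q) → q ≡ just c → p ≡ just c' → c ≢ c'
  neqM-sym h e e' eq = neqM-sound h e' e (sym eq)

  distB-sound : ∀ P → T (distB P) → ∀ d d' {c c'} → d ≢ d' → P d ≡ just c → P d' ≡ just c' → c ≢ c'
  distB-sound P h d d' ne = go d d' ne
    where
    s1 = splitB (neqM (P R) (P L)) _ h
    s2 = splitB (neqM (P R) (P D)) _ (proj₂ s1)
    s3 = splitB (neqM (P R) (P U)) _ (proj₂ s2)
    s4 = splitB (neqM (P L) (P D)) _ (proj₂ s3)
    s5 = splitB (neqM (P L) (P U)) _ (proj₂ s4)
    go : ∀ d d' {c c'} → d ≢ d' → P d ≡ just c → P d' ≡ just c' → c ≢ c'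
    go R R ne = ⊥-elim (ne refl)
    go L L ne = ⊥-elim (ne refl)
    go D D ne = ⊥-elim (ne refl)
    go U U ne = ⊥-elim (ne refl)
    go R L _ = neqM-sound (proj₁ s1)
    go R D _ = neqM-sound (proj₁ s2)
    go R U _ = neqM-sound (proj₁ s3)
    go L D _ = neqM-sound (proj₁ s4)
    go L U _ = neqM-sound (proj₁ s5)
    go D U _ = neqM-sound (proj₂ s5)
    go L R _ = neqM-sym (proj₁ s1)
    go D R _ = neqM-sym (proj₁ s2)
    go U R _ = neqM-sym (proj₁ s3)
    go D L _ = neqM-sym (proj₁ s4)
    go U L _ = neqM-sym (proj₁ s5)
    go U D _ = neqM-sym (proj₂ s5)

  memB : ℕ → List ℕ → Bool
  memB c [] = false
  memB c (x ∷ l) = (c N.≡ᵇ x) ∨ memB c l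

  memB-sound : ∀ c l → T (memB c l) → c ∈ l
  memB-sound c (x ∷ l) h with c N.≡ᵇ x in eq
  ... | true = here (NP.≡ᵇ⇒≡ c x (subst T (sym eq) tt))
  ... | false = there (memB-sound c l h)

  memB-complete : ∀ c l → c ∈ l → T (memB c l)
  memB-complete c (x ∷ l) (here refl) with c N.≡ᵇ c in eq
  ... | true = tt
  ... | false = ⊥-elim (subst T eq (NP.≡⇒≡ᵇ c c refl))
  memB-complete c (x ∷ l) (there p) with c N.≡ᵇ x
  ... | true = tt
  ... | false = memB-complete c l p

  subB : List ℕ → List ℕ → Bool
  subB [] l = true
  subB (x ∷ k) l = memB x l ∧ subB k l

  subB-sound : ∀ k l → T (subB k l) → ∀ {c} → c ∈ k → c ∈ l
  subB-sound (x ∷ k) l h (here refl) = memB-sound x l (T∧₁ h)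
  subB-sound (x ∷ k) l h (there p) = subB-sound k l (T∧₂ h) p

  subB-complete : ∀ k l → (∀ c → c ∈ k → c ∈ l) → T (subB k l)
  subB-complete [] l f = tt
  subB-complete (x ∷ k) l f with memB x l in eq
  ... | true = subB-complete k l (λ c p → f c (there p))
  ... | false = subst T eq (memB-complete x l (f x (here refl)))

  allFin : ∀ k → (Fin k → Bool) → Bool
  allFin zero P = true
  allFin (suc k) P = P F.zero ∧ allFin k (P ∘ F.suc)

  allFin-sound : ∀ k P → T (allFin k P) → ∀ i → T (P i)
  allFin-sound (suc k) P h F.zero = T∧₁ h
  allFin-sound (suc k) P h (F.suc i) = allFin-sound k (P ∘ F.suc) (T∧₂ h) i

  Faithful : ∀ {k} → (Fin k → List ℕ) → Set
  Faithful {k} pal = T (allFin k λ ℓ → allFin k λ ℓ' →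
    does (ℓ FP.≟ ℓ') ∨ not (subB (pal ℓ) (pal ℓ') ∧ subB (pal ℓ') (pal ℓ)))

  faithful-injective : ∀ {k} (pal : Fin k → List ℕ) → Faithful pal → ∀ ℓ ℓ' →
    (∀ c → c ∈ pal ℓ → c ∈ pal ℓ') → (∀ c → c ∈ pal ℓ' → c ∈ pal ℓ) → ℓ ≡ ℓ'
  faithful-injective {k} pal h ℓ ℓ' f g with ℓ FP.≟ ℓ' | allFin-sound k _ (allFin-sound k _ h ℓ) ℓ'
  ... | yes e | _ = e
  ... | no _ | h' with subB (pal ℓ) (pal ℓ') in e1 | subB (pal ℓ') (pal ℓ) in e2
  ... | false | _ = ⊥-elim (subst T e1 (subB-complete (pal ℓ) (pal ℓ') f))
  ... | true | false = ⊥-elim (subst T e2 (subB-complete (pal ℓ') (pal ℓ) g))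

  cm : Maybe ℕ → List ℕ → List ℕ
  cm nothing l = l
  cm (just c) l = c ∷ l

  plistB : (Dir → Maybe ℕ) → List ℕ
  plistB P = cm (P R) (cm (P L) (cm (P D) (cm (P U) [])))

  cm-in : ∀ p l {c} → c ∈ cm p l → (p ≡ just c) ⊎ (c ∈ l)
  cm-in nothing l h = inj₂ h
  cm-in (just x) l (here refl) = inj₁ refl
  cm-in (just x) l (there h) = inj₂ h

  in-cm₁ : ∀ p l {c} → p ≡ just c → c ∈ cm p l
  in-cm₁ (just x) l refl = here refl
  in-cm₂ : ∀ p l {c} → c ∈ l → c ∈ cm p l
  in-cm₂ nothing l h = h
  in-cm₂ (just x) l h = there h

  plist-in : ∀ P {c} → c ∈ plistB P → Σ Dir λ d → P d ≡ just c
  plist-in P h with cm-in (P R) _ h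
  ... | inj₁ e = R , e
  ... | inj₂ h2 with cm-in (P L) _ h2
  ... | inj₁ e = L , e
  ... | inj₂ h3 with cm-in (P D) _ h3
  ... | inj₁ e = D , e
  ... | inj₂ h4 with cm-in (P U) _ h4
  ... | inj₁ e = U , e
  ... | inj₂ ()

  in-plist : ∀ P {c} d → P d ≡ just c → c ∈ plistB P
  in-plist P R e = in-cm₁ (P R) _ e
  in-plist P L e = in-cm₂ (P R) _ (in-cm₁ (P L) _ e)
  in-plist P D e = in-cm₂ (P R) _ (in-cm₂ (P L) _ (in-cm₁ (P D) _ e))
  in-plist P U e = in-cm₂ (P R) _ (in-cm₂ (P L) _ (in-cm₂ (P D) _ (in-cm₁ (P U) _ e)))

  palB : (Dir → Maybe ℕ) → List ℕ → Bool
  palB P l = subB (plistB P) l ∧ subB l (plistB P)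

  palB-sound : ∀ P l → T (palB P l) → ∀ c → (Σ Dir λ d → P d ≡ just c) ⇔ (c ∈ l)
  palB-sound P l h c = mk⇔ (λ (d , e) → subB-sound (plistB P) l (T∧₁ h) (in-plist P d e))
                           (λ cl → plist-in P (subB-sound l (plistB P) (T∧₂ h) cl))

  ∧I : ∀ {a b} → T a → T b → T (a ∧ b)
  ∧I {true} {true} _ _ = tt

  locallyCorrect : (Dir → Profile → Maybe ℕ) → (Profile → Bool) → ∀ {k} → (Profile → Fin k) → (Fin k → List ℕ) →
    Profile → Bool
  locallyCorrect cport cons code pal t =
    not (cons t) ∨ (distB (λ d → cport d t) ∧ palB (λ d → cport d t) (pal (code t)))

  profile-construction : ∀ {m n k} (H V : ℕ → ℕ → ℕ) (cport : Dir → Profile → Maybe ℕ) (cons : Profile → Bool)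
    (code : Profile → Fin k) (pal : Fin k → List ℕ) →
    T (allProfiles (locallyCorrect cport cons code pal)) → Faithful pal →
    (∀ i j → i < m → j < n → T (cons (profileAt m n i j))) →
    (∀ d i j → i < m → j < n → Construction.portM {m} {n} H V d i j ≡ cport d (profileAt m n i j)) →
    Proper (Construction.φ {m} {n} H V) × AtMostPalettes (Construction.φ {m} {n} H V) k
  profile-construction {m} {n} H V cport cons code pal check faithful consOK portOK =
    Construction.construction-correct {m} {n} H V Profile (profileAt m n) cport (λ t → T (cons t)) consOK portOK
      (λ t ct → distB-sound (λ d → cport d t) (proj₁ (local t ct))) code pal
      (λ t ct → palB-sound (λ d → cport d t) (pal (code t)) (proj₂ (local t ct)))
      (faithful-injective pal faithful)
    where
    local : ∀ t → T (cons t) → T (distB (λ d → cport d t)) × T (palB (λ d → cport d t) (pal (code t)))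
    local t ct with cons t | allProfiles-sound {locallyCorrect cport cons code pal} check t
    ... | true | h = splitB _ _ h

  lastIdx : ∀ {i m} → i < m → (suc i N.<ᵇ m) ≡ false → suc i ≡ m
  lastIdx p e with NP.m≤n⇒m<n∨m≡n p
  ... | inj₁ lt = ⊥-elim (subst T e (NP.<⇒<ᵇ lt))
  ... | inj₂ eq = eq

  beq : Bool → Bool → Bool
  beq true b = b
  beq false b = not b

  r-u-ip : ∀ i → T (not ((i N.≡ᵇ 0) ∧ odd i))
  r-u-ip zero = tt
  r-u-ip (suc i) = tt

  r-z-jp : ∀ j → T (not ((j N.≡ᵇ 0) ∧ odd j))
  r-z-jp zero = tt
  r-z-jp (suc j) = tt

  r-last : ∀ {i m} → i < m → T ((suc i N.<ᵇ m) ∨ beq (odd i) (not (odd m)))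
  r-last {i} {m} p with suc i N.<ᵇ m in e
  ... | true = tt
  ... | false with lastIdx p e
  ... | refl with odd i
  ... | true = tt
  ... | false = tt

  r-first : ∀ j {n} → 2 ≤ n → T (not (j N.≡ᵇ 0) ∨ (suc j N.<ᵇ n))
  r-first zero {suc (suc n)} _ = tt
  r-first zero {suc zero} (s≤s ())
  r-first (suc j) _ = tt

  r-u-dd : ∀ i {m} → 2 ≤ m → T (not (i N.≡ᵇ 0) ∨ (suc i N.<ᵇ m))
  r-u-dd = r-first

-- Palettes: {0,1} at corners,
-- {0,1,2} on sides, {0,1,2,3} inside.

module EvenColouring (m n : ℕ) (mev : Profiles.odd m ≡ false) (m2 : 2 ≤ m) (n2 : 2 ≤ n) where
  open Profiles

  -- Colour of a vertical edge: row parity ip, first column z, inner column rr,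
  -- parity r of n.
  vE : Bool → Bool → Bool → Bool → ℕ
  vE ip z rr r = if z then (if ip then 2 else 1) else (if rr then (if ip then 3 else 2) else (if ip then 2 else b2n (not r)))

  Hf : ℕ → ℕ → ℕ
  Hf i j = b2n (odd j)
  Vf : ℕ → ℕ → ℕ
  Vf i j = vE (odd i) (j N.≡ᵇ 0) (suc j N.<ᵇ n) (odd n)

  cport : Bool → Dir → Profile → Maybe ℕ
  cport r R (profile u dd lr sl ip z rr z1 jp) = if rr then just (b2n jp) else nothing
  cport r L (profile u dd lr sl ip z rr z1 jp) = if z then nothing else just (b2n (not jp))
  cport r D (profile u dd lr sl ip z rr z1 jp) = if dd then just (vE ip z rr r) else nothing
  cport r U (profile u dd lr sl ip z rr z1 jp) = if u then nothing else just (vE (not ip) z rr r)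

  consB : Bool → Profile → Bool
  consB r (profile u dd lr sl ip z rr z1 jp) =
    not (u ∧ ip) ∧ (dd ∨ ip) ∧ not (z ∧ jp) ∧ (rr ∨ beq jp (not r)) ∧ (not z ∨ rr)

  -- Palette label: by the number of neighbours.
  code : Profile → Fin 3
  code (profile u dd lr sl ip z rr z1 jp) with not z ∧ rr | not u ∧ dd
  ... | true | true = F.suc (F.suc F.zero)
  ... | true | false = F.suc F.zero
  ... | false | true = F.suc F.zero
  ... | false | false = F.zero

  pal : Fin 3 → List ℕ
  pal F.zero = 0 ∷ 1 ∷ []
  pal (F.suc F.zero) = 0 ∷ 1 ∷ 2 ∷ []
  pal (F.suc (F.suc F.zero)) = 0 ∷ 1 ∷ 2 ∷ 3 ∷ []

  checkAll : ∀ r → T (allProfiles (locallyCorrect (cport r) (consB r) code pal))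
  checkAll true = tt
  checkAll false = tt

  open import Data.Bool.Properties using (not-involutive)

  beqT : ∀ a b → T (a ∨ beq b true) → T (a ∨ b)
  beqT a true h = h
  beqT a false h = h

  consOK : ∀ i j → i < m → j < n → T (consB (odd n) (profileAt m n i j))
  consOK i j p q =
    ∧I (r-u-ip i) (∧I (beqT _ (odd i) (subst (λ b → T ((suc i N.<ᵇ m) ∨ beq (odd i) (not b))) mev (r-last p)))
      (∧I (r-z-jp j) (∧I (r-last q) (r-first j n2))))

  open Construction {m} {n} Hf Vf

  portOK : ∀ d i j → i < m → j < n → portM d i j ≡ cport (odd n) d (profileAt m n i j)
  portOK R i j p q = refl
  portOK L i zero p q = refl
  portOK L i (suc j) p q = cong (just ∘ b2n) (sym (not-involutive (odd j)))
  portOK D i j p q = refl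
  portOK U zero j p q = refl
  portOK U (suc i) j p q = cong (λ b → just (vE b (j N.≡ᵇ 0) (suc j N.<ᵇ n) (odd n))) (sym (not-involutive (odd i)))

  result : Proper φ × AtMostPalettes φ 3
  result = profile-construction Hf Vf (cport (odd n)) (consB (odd n)) code pal (checkAll (odd n)) tt consOK portOK

  colouring : Σ (EdgeColouring m n) λ ψ → Proper ψ × AtMostPalettes ψ 3
  colouring = φ , result

  -- Without interior rows (no position has both a row above and a row below)
  -- the label 2 of the interior palette {0,1,2,3} never occurs.
  codeN2 : ∀ u dd lr sl ip z rr z1 jp → (not u ∧ dd) ≡ false → code (profile u dd lr sl ip z rr z1 jp) ≢ F.suc (F.suc F.zero)
  codeN2 u dd lr sl ip z rr z1 jp e with not z ∧ rr | not u ∧ dd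
  ... | true | false = λ ()
  ... | false | false = λ ()
  ... | _ | true = λ _ → case e of λ ()

  codeTy : ∀ i j → (not (i N.≡ᵇ 0) ∧ (suc i N.<ᵇ m)) ≡ false → code (profileAt m n i j) ≢ F.suc (F.suc F.zero)
  codeTy i j e = codeN2 (i N.≡ᵇ 0) (suc i N.<ᵇ m) (suc i N.≡ᵇ m) (suc (suc i) N.≡ᵇ m) (odd i) (j N.≡ᵇ 0) (suc j N.<ᵇ n) (j N.≡ᵇ 1) (odd j) e

module ProfileFacts where
  open Profiles
  ≡ᵇ-refl : ∀ k → (k N.≡ᵇ k) ≡ true
  ≡ᵇ-refl zero = refl
  ≡ᵇ-refl (suc k) = ≡ᵇ-refl k

  <ᵇ-irr : ∀ k → (k N.<ᵇ k) ≡ false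
  <ᵇ-irr zero = refl
  <ᵇ-irr (suc k) = <ᵇ-irr k

  ≡ᵇ-true : ∀ a b → (a N.≡ᵇ b) ≡ true → a ≡ b
  ≡ᵇ-true a b e = NP.≡ᵇ⇒≡ a b (subst T (sym e) tt)

  r-lr : ∀ {i m} → i < m → T (beq (suc i N.≡ᵇ m) (not (suc i N.<ᵇ m)))
  r-lr {i} {m} p with suc i N.<ᵇ m in e
  ... | false = subst (λ k → T (beq (k N.≡ᵇ m) true)) (sym (lastIdx p e)) (subst (λ b → T (beq b true)) (sym (≡ᵇ-refl m)) tt)
  ... | true with suc i N.≡ᵇ m in e2
  ... | false = tt
  ... | true with ≡ᵇ-true (suc i) m e2
  ... | refl = subst T (trans (sym e) (<ᵇ-irr (suc i))) tt

  r-sl-ip : ∀ i m → odd m ≡ true → T (not (suc (suc i) N.≡ᵇ m) ∨ odd i)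
  r-sl-ip i m om with suc (suc i) N.≡ᵇ m in e
  ... | false = tt
  ... | true with ≡ᵇ-true (suc (suc i)) m e
  ... | refl = subst T (sym (trans (sym (not-involutive (odd i))) om)) tt
    where open import Data.Bool.Properties using (not-involutive)

  r-sl-dd : ∀ i m → T (not (suc (suc i) N.≡ᵇ m) ∨ (suc i N.<ᵇ m))
  r-sl-dd i m with suc (suc i) N.≡ᵇ m in e
  ... | false = tt
  ... | true with ≡ᵇ-true (suc (suc i)) m e
  ... | refl = NP.<⇒<ᵇ (NP.n<1+n (suc i))

  r-sl-u : ∀ i m → 3 ≤ m → T (not ((suc (suc i) N.≡ᵇ m) ∧ (i N.≡ᵇ 0)))
  r-sl-u (suc i) m _ with suc (suc (suc i)) N.≡ᵇ m
  ... | true = tt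
  ... | false = tt
  r-sl-u zero (suc (suc (suc m))) _ = tt
  r-sl-u zero (suc (suc zero)) (s≤s (s≤s ()))
  r-sl-u zero (suc zero) (s≤s ())
  r-sl-u zero zero ()

  r-z1-jp : ∀ j → T (not (j N.≡ᵇ 1) ∨ odd j)
  r-z1-jp zero = tt
  r-z1-jp (suc zero) = tt
  r-z1-jp (suc (suc j)) = tt

  r-z1-rr : ∀ j n → 3 ≤ n → T (not (j N.≡ᵇ 1) ∨ (suc j N.<ᵇ n))
  r-z1-rr zero n _ = tt
  r-z1-rr (suc zero) (suc (suc (suc n))) _ = tt
  r-z1-rr (suc zero) (suc (suc zero)) (s≤s (s≤s ()))
  r-z1-rr (suc zero) (suc zero) (s≤s ())
  r-z1-rr (suc zero) zero ()
  r-z1-rr (suc (suc j)) n _ = tt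

  r-z-z1 : ∀ j → T (not ((j N.≡ᵇ 0) ∧ (j N.≡ᵇ 1)))
  r-z-z1 zero = tt
  r-z-z1 (suc j) = tt

-- The colouring for m, n odd, with five palettes {0,1}, {2,3} (two corners
-- each), {0,1,2}, {0,1,3} (sides) and {0,1,2,3} (interior).  The last two
-- rows and the first two columns are treated specially ('sl', 'lr', 'z1').

module OddColouring (m n : ℕ) (mod : Profiles.odd m ≡ true) (nod : Profiles.odd n ≡ true) (m3 : 3 ≤ m) (n3 : 3 ≤ n) where
  open Profiles
  open ProfileFacts

  -- Colour of a horizontal edge: inner row dd, second-to-last row sl,
  -- first column z, column parity jp.
  hf : Bool → Bool → Bool → Bool → ℕ
  hf dd sl z jp = if not dd then (if z then 3 else (if jp then 0 else 2))
                  else (if sl then (if jp then 3 else 0) else b2n jp)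

  -- Colour of a vertical edge: second-to-last row sl, row parity ip,
  -- first column z, inner column rr.
  vf : Bool → Bool → Bool → Bool → ℕ
  vf sl ip z rr = if sl then (if z then 2 else 1)
                  else (if z then (if ip then 2 else 1)
                  else (if not rr then (if ip then 2 else 0) else (if ip then 3 else 2)))

  Hf : ℕ → ℕ → ℕ
  Hf i j = hf (suc i N.<ᵇ m) (suc (suc i) N.≡ᵇ m) (j N.≡ᵇ 0) (odd j)
  Vf : ℕ → ℕ → ℕ
  Vf i j = vf (suc (suc i) N.≡ᵇ m) (odd i) (j N.≡ᵇ 0) (suc j N.<ᵇ n)

  cport : Dir → Profile → Maybe ℕ
  cport R (profile u dd lr sl ip z rr z1 jp) = if rr then just (hf dd sl z jp) else nothing
  cport L (profile u dd lr sl ip z rr z1 jp) = if z then nothing else just (hf dd sl z1 (not jp))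
  cport D (profile u dd lr sl ip z rr z1 jp) = if dd then just (vf sl ip z rr) else nothing
  cport U (profile u dd lr sl ip z rr z1 jp) = if u then nothing else just (vf lr (not ip) z rr)

  consB : Profile → Bool
  consB (profile u dd lr sl ip z rr z1 jp) =
    not (u ∧ ip) ∧ (dd ∨ not ip) ∧ beq lr (not dd) ∧ (not sl ∨ ip) ∧ (not sl ∨ dd) ∧ not (sl ∧ u) ∧
    (not u ∨ dd) ∧ not (z ∧ jp) ∧ (rr ∨ not jp) ∧ (not z ∨ rr) ∧ (not z1 ∨ jp) ∧ (not z1 ∨ rr) ∧ not (z ∧ z1)

  c0 c1 c2 c3 c4 : Fin 5
  c0 = F.zero
  c1 = F.suc F.zero
  c2 = F.suc (F.suc F.zero)
  c3 = F.suc (F.suc (F.suc F.zero))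
  c4 = F.suc (F.suc (F.suc (F.suc F.zero)))

  -- Palette label: interior, corners split by {0,1}/{2,3}, sides by {0,1,2}/{0,1,3}.
  code : Profile → Fin 5
  code (profile u dd lr sl ip z rr z1 jp) with not z ∧ rr | not u ∧ dd
  ... | true | true = c4
  ... | false | false = if lr ∧ z then c1 else c0
  ... | _ | _ = if (sl ∧ not rr) ∨ (lr ∧ z1) then c3 else c2

  pal : Fin 5 → List ℕ
  pal F.zero = 0 ∷ 1 ∷ []
  pal (F.suc F.zero) = 2 ∷ 3 ∷ []
  pal (F.suc (F.suc F.zero)) = 0 ∷ 1 ∷ 2 ∷ []
  pal (F.suc (F.suc (F.suc F.zero))) = 0 ∷ 1 ∷ 3 ∷ []
  pal (F.suc (F.suc (F.suc (F.suc F.zero)))) = 0 ∷ 1 ∷ 2 ∷ 3 ∷ []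

  open import Data.Bool.Properties using (not-involutive)

  beqF : ∀ a b → T (a ∨ beq b false) → T (a ∨ not b)
  beqF a true h = h
  beqF a false h = h

  consOK : ∀ i j → i < m → j < n → T (consB (profileAt m n i j))
  consOK i j p q =
    ∧I (r-u-ip i) (∧I (beqF _ (odd i) (subst (λ b → T ((suc i N.<ᵇ m) ∨ beq (odd i) (not b))) mod (r-last p)))
    (∧I (r-lr p) (∧I (r-sl-ip i m mod) (∧I (r-sl-dd i m) (∧I (r-sl-u i m m3) (∧I (r-u-dd i (NP.≤-trans (s≤s (s≤s z≤n)) m3))
    (∧I (r-z-jp j) (∧I (beqF _ (odd j) (subst (λ b → T ((suc j N.<ᵇ n) ∨ beq (odd j) (not b))) nod (r-last q)))
    (∧I (r-first j (NP.≤-trans (s≤s (s≤s z≤n)) n3)) (∧I (r-z1-jp j) (∧I (r-z1-rr j n n3) (r-z-z1 j))))))))))))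

  open Construction {m} {n} Hf Vf

  portOK : ∀ d i j → i < m → j < n → portM d i j ≡ cport d (profileAt m n i j)
  portOK R i j p q = refl
  portOK L i zero p q = refl
  portOK L i (suc j) p q = cong (λ b → just (hf (suc i N.<ᵇ m) (suc (suc i) N.≡ᵇ m) (j N.≡ᵇ 0) b)) (sym (not-involutive (odd j)))
  portOK D i j p q = refl
  portOK U zero j p q = refl
  portOK U (suc i) j p q = cong (λ b → just (vf (suc (suc i) N.≡ᵇ m) b (j N.≡ᵇ 0) (suc j N.<ᵇ n))) (sym (not-involutive (odd i)))

  result : Proper φ × AtMostPalettes φ 5
  result = profile-construction Hf Vf cport consB code pal tt tt consOK portOK

  colouring : Σ (EdgeColouring m n) λ ψ → Proper ψ × AtMostPalettes ψ 5
  colouring = φ , result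

module Transpose {m n : ℕ} (φ : EdgeColouring n m) where
  open import Data.Sum using (swap)
  sw : Vertex m n → Vertex n m
  sw x = proj₂ x , proj₁ x

  ψ : EdgeColouring m n
  ψ x y s = φ (sw x) (sw y) (swap s)

  swA : ∀ {x y} → Adj x y → Adj {n} {m} (sw x) (sw y)
  swA (inj₁ s) = inj₁ (swap s)
  swA (inj₂ s) = inj₂ (swap s)

  sw' : Vertex n m → Vertex m n
  sw' x = proj₂ x , proj₁ x

  swA' : ∀ {x y} → Adj {n} {m} x y → Adj {m} {n} (sw' x) (sw' y)
  swA' (inj₁ s) = inj₁ (swap s)
  swA' (inj₂ s) = inj₂ (swap s)

  colEq : ∀ {x y} (a : Adj x y) → colourAt ψ a ≡ colourAt φ (swA a)
  colEq (inj₁ s) = refl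
  colEq (inj₂ s) = refl

  colEq' : ∀ {x y} (a : Adj {n} {m} x y) → colourAt ψ (swA' a) ≡ colourAt φ a
  colEq' (inj₁ (inj₁ s)) = refl
  colEq' (inj₁ (inj₂ s)) = refl
  colEq' (inj₂ (inj₁ s)) = refl
  colEq' (inj₂ (inj₂ s)) = refl

  properT : Proper φ → Proper ψ
  properT pr x y z a b ne eq = pr (sw x) (sw y) (sw z) (swA a) (swA b) (λ e → ne (cong sw' e))
    (trans (sym (colEq a)) (trans eq (colEq b)))

  palT : ∀ x c → InPalette ψ x c ⇔ InPalette φ (sw x) c
  palT x c = mk⇔ (λ (y , a , e) → sw y , swA a , trans (sym (colEq a)) e)
                 (λ (y , a , e) → sw' y , swA' a , trans (colEq' a) e)

  spT : ∀ x y → SamePalette ψ x y ⇔ SamePalette φ (sw x) (sw y)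
  spT x y = mk⇔ (λ sp c → mk⇔ (λ h → Equivalence.to (palT y c) (Equivalence.to (sp c) (Equivalence.from (palT x c) h)))
                               (λ h → Equivalence.to (palT x c) (Equivalence.from (sp c) (Equivalence.from (palT y c) h))))
                (λ sp c → mk⇔ (λ h → Equivalence.from (palT y c) (Equivalence.to (sp c) (Equivalence.to (palT x c) h)))
                               (λ h → Equivalence.from (palT x c) (Equivalence.from (sp c) (Equivalence.to (palT y c) h))))

  atT : ∀ {k} → AtMostPalettes φ k → AtMostPalettes ψ k
  atT (f , fOK) = (λ x → f (sw x)) , λ x y →
    mk⇔ (λ e → Equivalence.from (spT x y) (Equivalence.to (fOK (sw x) (sw y)) e))
        (λ sp → Equivalence.from (fOK (sw x) (sw y)) (Equivalence.to (spT x y) sp))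

transpose-colouring : ∀ {m n k} → (Σ (EdgeColouring n m) λ φ → Proper φ × AtMostPalettes φ k) →
         Σ (EdgeColouring m n) λ ψ → Proper ψ × AtMostPalettes ψ k
transpose-colouring (φ , pr , at) = Transpose.ψ φ , Transpose.properT φ pr , Transpose.atT φ at

relabel-palettes : ∀ {m n} {φ : EdgeColouring m n} {k k'} (at : AtMostPalettes φ k) (h : Fin k → Fin k') →
  (∀ x y → h (proj₁ at x) ≡ h (proj₁ at y) → proj₁ at x ≡ proj₁ at y) → AtMostPalettes φ k'
relabel-palettes (f , fOK) h inj = (λ x → h (f x)) , λ x y →
  mk⇔ (λ e → Equivalence.to (fOK x y) (inj x y e)) (λ sp → cong h (Equivalence.from (fOK x y) sp))

module FiniteSums where
  open Profiles using (odd; b2n)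
  open import Data.Nat.Tactic.RingSolver using (solve-∀)
  open import Data.Bool.Properties using (not-involutive)

  sum : ℕ → (ℕ → ℕ) → ℕ
  sum zero f = 0
  sum (suc K) f = f 0 + sum K (λ i → f (suc i))

  sum-cong : ∀ K {f g} → (∀ i → i < K → f i ≡ g i) → sum K f ≡ sum K g
  sum-cong zero h = refl
  sum-cong (suc K) h = cong₂ _+_ (h 0 (s≤s z≤n)) (sum-cong K (λ i p → h (suc i) (s≤s p)))

  sum-+ : ∀ K f g → sum K (λ i → f i + g i) ≡ sum K f + sum K g
  sum-+ zero f g = refl
  sum-+ (suc K) f g rewrite sum-+ K (λ i → f (suc i)) (λ i → g (suc i)) = lem (f 0) (g 0) (sum K (λ i → f (suc i))) (sum K (λ i → g (suc i)))
    where lem : ∀ a b c d → a + b + (c + d) ≡ a + c + (b + d)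
          lem = solve-∀

  sum-*ʳ : ∀ K f t → sum K (λ i → f i * t) ≡ sum K f * t
  sum-*ʳ zero f t = refl
  sum-*ʳ (suc K) f t rewrite sum-*ʳ K (λ i → f (suc i)) t = sym (NP.*-distribʳ-+ t (f 0) (sum K (λ i → f (suc i))))

  sum-const : ∀ K t → sum K (λ _ → t) ≡ K * t
  sum-const zero t = refl
  sum-const (suc K) t = cong (t +_) (sum-const K t)

  sum-last : ∀ K f → sum (suc K) f ≡ sum K f + f K
  sum-last zero f = NP.+-comm (f 0) 0
  sum-last (suc K) f rewrite sum-last K (λ i → f (suc i)) = sym (NP.+-assoc (f 0) _ _)

  sum-swap : ∀ K Q (f : ℕ → ℕ → ℕ) → sum K (λ i → sum Q (λ j → f i j)) ≡ sum Q (λ j → sum K (λ i → f i j))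
  sum-swap zero Q f = sym (trans (sum-const Q 0) (NP.*-zeroʳ Q))
  sum-swap (suc K) Q f = trans (cong (sum Q (λ j → f 0 j) +_) (sum-swap K Q (λ i j → f (suc i) j)))
                           (sym (sum-+ Q (λ j → f 0 j) (λ j → sum K (λ i → f (suc i) j))))

  xor : Bool → Bool → Bool
  xor true b = not b
  xor false b = b

  odd-+ : ∀ a b → odd (a + b) ≡ xor (odd a) (odd b)
  odd-+ zero b = refl
  odd-+ (suc a) b rewrite odd-+ a b with odd a
  ... | true = not-involutive (odd b)
  ... | false = refl

  odd-double : ∀ a → odd (a + a) ≡ false
  odd-double a rewrite odd-+ a a with odd a
  ... | true = refl
  ... | false = refl

  odd-* : ∀ a b → odd (a * b) ≡ odd a ∧ odd b
  odd-* zero b = refl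
  odd-* (suc a) b rewrite odd-+ b (a * b) | odd-* a b with odd a | odd b
  ... | true | true = refl
  ... | true | false = refl
  ... | false | true = refl
  ... | false | false = refl

-- For arbitrary weights hH, hV on horizontal and vertical
-- edges, the sum over all vertices of the weights of their incident edges
-- ('incidentSum') is even, since every edge is counted at both endpoints.

module Handshake (m n : ℕ) where
  open Profiles using (odd)
  open FiniteSums
  open ≡-Reasoning

  toNext : ℕ → (ℕ → ℕ) → ℕ → ℕ
  toNext K h j = if suc j N.<ᵇ K then h j else 0

  toPrev : (ℕ → ℕ) → ℕ → ℕ
  toPrev h zero = 0
  toPrev h (suc j) = h j

  incidentSum : (ℕ → ℕ → ℕ) → (ℕ → ℕ → ℕ) → ℕ → ℕ → ℕ
  incidentSum hH hV i j =
    (toNext n (hH i) j + toPrev (hH i) j) + (toNext m (λ i' → hV i' j) i + toPrev (λ i' → hV i' j) i)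

  gridSum : (ℕ → ℕ → ℕ) → ℕ
  gridSum G = sum m (λ i → sum n (λ j → G i j))

  <ᵇ-true : ∀ {a b} → a < b → (a N.<ᵇ b) ≡ true
  <ᵇ-true {a} {b} p with a N.<ᵇ b in e
  ... | true = refl
  ... | false = ⊥-elim (subst T e (NP.<⇒<ᵇ p))

  sum-toNext : ∀ K h → sum (suc K) (toNext (suc K) h) ≡ sum K h
  sum-toNext K h = begin
    sum (suc K) (toNext (suc K) h)      ≡⟨ sum-last K _ ⟩
    sum K (toNext (suc K) h) + toNext (suc K) h K
      ≡⟨ cong₂ _+_ (sum-cong K (λ j p → cong (λ b → if b then h j else 0) (<ᵇ-true (s≤s p))))
                   (cong (λ b → if b then h K else 0) (ProfileFacts.<ᵇ-irr K)) ⟩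
    sum K h + 0                        ≡⟨ NP.+-identityʳ _ ⟩
    sum K h                            ∎

  path-handshake : ∀ K h → sum K (λ j → toNext K h j + toPrev h j) ≡ sum (N.pred K) h + sum (N.pred K) h
  path-handshake zero h = refl
  path-handshake (suc K) h = trans (sum-+ (suc K) (toNext (suc K) h) (toPrev h)) (cong (_+ sum K h) (sum-toNext K h))

  -- Rows and columns of the grid are paths.
  handshake-even : ∀ hH hV → odd (gridSum (incidentSum hH hV)) ≡ false
  handshake-even hH hV = begin
    odd (gridSum (incidentSum hH hV))
      ≡⟨ cong odd (trans (sum-cong m (λ i _ → sum-+ n _ _)) (sum-+ m _ _)) ⟩
    odd (sum m (λ i → sum n (λ j → toNext n (hH i) j + toPrev (hH i) j))
         + sum m (λ i → sum n (λ j → toNext m (λ i' → hV i' j) i + toPrev (λ i' → hV i' j) i)))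
      ≡⟨ cong odd (cong₂ _+_ rows columns) ⟩
    odd ((X + X) + (Y + Y))
      ≡⟨ odd-+ (X + X) (Y + Y) ⟩
    xor (odd (X + X)) (odd (Y + Y))
      ≡⟨ cong₂ xor (odd-double X) (odd-double Y) ⟩
    false ∎
    where
    X = sum m (λ i → sum (N.pred n) (hH i))
    Y = sum n (λ j → sum (N.pred m) (λ i → hV i j))
    rows : sum m (λ i → sum n (λ j → toNext n (hH i) j + toPrev (hH i) j)) ≡ X + X
    rows = trans (sum-cong m (λ i _ → path-handshake n (hH i))) (sum-+ m _ _)
    columns : sum m (λ i → sum n (λ j → toNext m (λ i' → hV i' j) i + toPrev (λ i' → hV i' j) i)) ≡ Y + Y
    columns = trans (sum-swap m n _) (trans (sum-cong n (λ j _ → path-handshake m (λ i → hV i j))) (sum-+ n _ _))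

module ListSums where
  sumL : (ℕ → ℕ) → List ℕ → ℕ
  sumL g [] = 0
  sumL g (c ∷ l) = g c + sumL g l

  rem : ∀ {c} (l : List ℕ) → c ∈ l → List ℕ
  rem (x ∷ l) (here _) = l
  rem (x ∷ l) (there p) = x ∷ rem l p

  rem-sum : ∀ g {c} l (p : c ∈ l) → sumL g l ≡ g c + sumL g (rem l p)
  rem-sum g (x ∷ l) (here refl) = refl
  rem-sum g {c} (x ∷ l) (there p) rewrite rem-sum g l p = lem (g x) (g c) (sumL g (rem l p))
    where lem : ∀ a b d → a + (b + d) ≡ b + (a + d)
          lem a b d = trans (sym (NP.+-assoc a b d)) (trans (cong (_+ d) (NP.+-comm a b)) (NP.+-assoc b a d))

  rem-sub : ∀ {c z} l (p : c ∈ l) → z ∈ rem l p → z ∈ l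
  rem-sub (x ∷ l) (here _) h = there h
  rem-sub (x ∷ l) (there p) (here e) = here e
  rem-sub (x ∷ l) (there p) (there h) = there (rem-sub l p h)

  rem-keep : ∀ {c z} l (p : c ∈ l) → z ∈ l → z ≢ c → z ∈ rem l p
  rem-keep (x ∷ l) (here refl) (here refl) ne = ⊥-elim (ne refl)
  rem-keep (x ∷ l) (here refl) (there h) ne = h
  rem-keep (x ∷ l) (there p) (here e) ne = here e
  rem-keep (x ∷ l) (there p) (there h) ne = there (rem-keep l p h ne)

  rem-uniq : ∀ {c} l (p : c ∈ l) → Distinct l → Distinct (rem l p)
  rem-uniq (x ∷ l) (here _) (_ ∷ᵘ u) = u
  rem-uniq (x ∷ l) (there p) (nx ∷ᵘ u) = (λ h → nx (rem-sub l p h)) ∷ᵘ rem-uniq l p u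

  rem-not : ∀ {c} l (p : c ∈ l) → Distinct l → c ∉ rem l p
  rem-not (x ∷ l) (here refl) (nx ∷ᵘ u) h = nx h
  rem-not (x ∷ l) (there p) (nx ∷ᵘ u) (here refl) = nx p
  rem-not (x ∷ l) (there p) (nx ∷ᵘ u) (there h) = rem-not l p u h

  sameSum : ∀ g l l' → Distinct l → Distinct l' → (∀ z → z ∈ l → z ∈ l') → (∀ z → z ∈ l' → z ∈ l) → sumL g l ≡ sumL g l'
  sameSum g [] [] _ _ _ _ = refl
  sameSum g [] (x ∷ l') _ _ _ s2 with s2 x (here refl)
  ... | ()
  sameSum g (c ∷ l) l' (nc ∷ᵘ u) u' s1 s2 =
    let p = s1 c (here refl)
    in trans (cong (g c +_) (sameSum g l (rem l' p) u (rem-uniq l' p u')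
                 (λ z zl → rem-keep l' p (s1 z (there zl)) (λ e → nc (subst (_∈ l) e zl)))
                 (λ z zr → go z zr)))
             (sym (rem-sum g l' p))
    where
    go : ∀ z → z ∈ rem l' (s1 c (here refl)) → z ∈ l
    go z zr with s2 z (rem-sub l' (s1 c (here refl)) zr)
    ... | here refl = ⊥-elim (rem-not l' (s1 c (here refl)) u' zr)
    ... | there h = h

module PaletteLists (M N : ℕ) (φ : EdgeColouring (suc M) (suc N)) (pr : Proper φ) {k : ℕ}
          (f : Vertex (suc M) (suc N) → Fin k) (fOK : (x y : Vertex (suc M) (suc N)) → (f x ≡ f y) ⇔ SamePalette φ x y) where
  m = suc M
  n = suc N

  open Ports φ public
  open Profiles using (odd; b2n; cm; plistB; cm-in; in-cm₁; in-cm₂; memB; memB-sound; memB-complete; plist-in; in-plist)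
  open ProfileFacts using (<ᵇ-irr; ≡ᵇ-refl; ≡ᵇ-true)
  open FiniteSums
  open Handshake m n public
  open ListSums using (sumL)
  open import Data.Nat.Tactic.RingSolver using (solve-∀)

  paletteAt : ℕ → ℕ → List ℕ
  paletteAt i j = plistB (λ d → port d i j)

  -- Coordinates as vertices (clamped, exact below the bound).
  fin : (K : ℕ) → ℕ → Fin (suc K)
  fin K i = fromℕ< (s≤s (NP.m⊓n≤n i K))

  toℕ-fin : ∀ K i → i < suc K → toℕ (fin K i) ≡ i
  toℕ-fin K i (s≤s p) = trans (FP.toℕ-fromℕ< (s≤s (NP.m⊓n≤n i K))) (NP.m≤n⇒m⊓n≡m p)

  vertexAt : ℕ → ℕ → Vertex m n
  vertexAt i j = fin M i , fin N j

  labelAt : ℕ → ℕ → Fin k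
  labelAt i j = f (vertexAt i j)

  ports-distinct : PortsDistinct
  ports-distinct = proper⇒ports-distinct pr

  distinct-cm : ∀ p l → (∀ c → p ≡ just c → c ∉ l) → Distinct l → Distinct (cm p l)
  distinct-cm nothing l h u = u
  distinct-cm (just c) l h u = h c refl ∷ᵘ u

  ports-distinct⇒list-distinct : ∀ (P : Dir → Maybe ℕ) → (∀ d d' {c c'} → d ≢ d' → P d ≡ just c → P d' ≡ just c' → c ≢ c') → Distinct (plistB P)
  ports-distinct⇒list-distinct P h =
    distinct-cm (P R) _ (λ c e cin → in3 c e cin)
      (distinct-cm (P L) _ (λ c e cin → in2 c e cin)
        (distinct-cm (P D) _ (λ c e cin → in1 c e cin)
          (distinct-cm (P U) [] (λ c e ()) []ᵘ)))
    where
    in1 : ∀ c → P D ≡ just c → c ∉ cm (P U) []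
    in1 c e cin with cm-in (P U) [] cin
    ... | inj₁ e' = h D U (λ ()) e e' refl
    ... | inj₂ ()
    in2 : ∀ c → P L ≡ just c → c ∉ cm (P D) (cm (P U) [])
    in2 c e cin with cm-in (P D) _ cin
    ... | inj₁ e' = h L D (λ ()) e e' refl
    ... | inj₂ cin' with cm-in (P U) [] cin'
    ... | inj₁ e' = h L U (λ ()) e e' refl
    ... | inj₂ ()
    in3 : ∀ c → P R ≡ just c → c ∉ cm (P L) (cm (P D) (cm (P U) []))
    in3 c e cin with cm-in (P L) _ cin
    ... | inj₁ e' = h R L (λ ()) e e' refl
    ... | inj₂ cin' with cm-in (P D) _ cin'
    ... | inj₁ e' = h R D (λ ()) e e' refl
    ... | inj₂ cin'' with cm-in (P U) [] cin''
    ... | inj₁ e' = h R U (λ ()) e e' refl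
    ... | inj₂ ()

  paletteAt-distinct : ∀ i j → i < m → j < n → Distinct (paletteAt i j)
  paletteAt-distinct i j p q = subst₂ (λ a b → Distinct (paletteAt a b)) (toℕ-fin M i p) (toℕ-fin N j q)
                    (ports-distinct⇒list-distinct _ (λ d d' ne e e' → ports-distinct (fin M i) (fin N j) d d' ne e e'))

  paletteAt-correct : ∀ i j c → i < m → j < n → InPalette φ (vertexAt i j) c ⇔ (c ∈ paletteAt i j)
  paletteAt-correct i j c p q = mk⇔
    (λ ip → let (d , e) = Equivalence.to (palette⇔ports (vertexAt i j) c) ip in
            in-plist (λ d → port d i j) d (subst₂ (λ a b → port d a b ≡ just c) (toℕ-fin M i p) (toℕ-fin N j q) e))
    (λ cin → let (d , e) = plist-in (λ d → port d i j) cin in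
            Equivalence.from (palette⇔ports (vertexAt i j) c) (d , subst₂ (λ a b → port d a b ≡ just c) (sym (toℕ-fin M i p)) (sym (toℕ-fin N j q)) e))

  record Pos : Set where
    constructor pos
    field
      pi pj : ℕ
      pim : pi < m
      pjn : pj < n
  open Pos public

  P : Pos → List ℕ
  P v = paletteAt (pi v) (pj v)

  lb : Pos → Fin k
  lb v = labelAt (pi v) (pj v)

  sameLabel⇒⊆ : ∀ v w → lb v ≡ lb w → ∀ c → c ∈ P v → c ∈ P w
  sameLabel⇒⊆ v w e c cin = Equivalence.to (paletteAt-correct (pi w) (pj w) c (pim w) (pjn w))
    (Equivalence.to (Equivalence.to (fOK (vertexAt (pi v) (pj v)) (vertexAt (pi w) (pj w))) e c) (Equivalence.from (paletteAt-correct (pi v) (pj v) c (pim v) (pjn v)) cin))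

  paletteAt-distinctᵖ : ∀ v → Distinct (P v)
  paletteAt-distinctᵖ v = paletteAt-distinct (pi v) (pj v) (pim v) (pjn v)

  smaller-palette⇒other-label : ∀ v w → length (P v) < length (P w) → lb v ≢ lb w
  smaller-palette⇒other-label v w lt e = NP.<⇒≱ lt (distinct-length-≤ (P w) (P v) (paletteAt-distinctᵖ w) (λ {c} → sameLabel⇒⊆ w v (sym e) c))

  memB-false : ∀ x l → x ∉ l → memB x l ≡ false
  memB-false x l nx with memB x l in e
  ... | true = ⊥-elim (nx (memB-sound x l (subst T (sym e) tt)))
  ... | false = refl

  ≡ᵇ-sym : ∀ a b → (a N.≡ᵇ b) ≡ (b N.≡ᵇ a)
  ≡ᵇ-sym zero zero = refl
  ≡ᵇ-sym zero (suc b) = refl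
  ≡ᵇ-sym (suc a) zero = refl
  ≡ᵇ-sym (suc a) (suc b) = ≡ᵇ-sym a b

  isColour : ℕ → ℕ → ℕ
  isColour x c = b2n (c N.≡ᵇ x)

  count-distinct : ∀ x l → Distinct l → sumL (isColour x) l ≡ b2n (memB x l)
  count-distinct x [] _ = refl
  count-distinct x (c ∷ l) (nc ∷ᵘ u) with c N.≡ᵇ x in e
  count-distinct x (c ∷ l) (nc ∷ᵘ u) | true with ≡ᵇ-true c x e
  count-distinct x (.x ∷ l) (nc ∷ᵘ u) | true | refl rewrite ≡ᵇ-refl x | count-distinct x l u | memB-false x l nc = refl
  count-distinct x (c ∷ l) (nc ∷ᵘ u) | false rewrite ≡ᵇ-sym x c | e = count-distinct x l u

  portWeight : (ℕ → ℕ) → Maybe ℕ → ℕ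
  portWeight g nothing = 0
  portWeight g (just c) = g c

  sum-cm : ∀ g p l → sumL g (cm p l) ≡ portWeight g p + sumL g l
  sum-cm g nothing l = refl
  sum-cm g (just c) l = refl

  portWeight-if : ∀ g b c → portWeight g (if b then just c else nothing) ≡ (if b then g c else 0)
  portWeight-if g true c = refl
  portWeight-if g false c = refl

  portWeight-L : ∀ g i j → portWeight g (port L i j) ≡ toPrev (λ j → g (hColour i j)) j
  portWeight-L g i zero = refl
  portWeight-L g i (suc j) = refl

  portWeight-U : ∀ g i j → portWeight g (port U i j) ≡ toPrev (λ i → g (vColour i j)) i
  portWeight-U g zero j = refl
  portWeight-U g (suc i) j = refl

  sum-palette : ∀ g i j → sumL g (paletteAt i j) ≡ incidentSum (λ i j → g (hColour i j)) (λ i j → g (vColour i j)) i j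
  sum-palette g i j = begin
    sumL g (paletteAt i j)
      ≡⟨ trans (sum-cm g (port R i j) _) (cong (wR +_) (trans (sum-cm g (port L i j) _)
           (cong (wL +_) (trans (sum-cm g (port D i j) _) (cong (wD +_) (sum-cm g (port U i j) [])))))) ⟩
    wR + (wL + (wD + (wU + 0)))
      ≡⟨ regroup wR wL wD wU ⟩
    (wR + wL) + (wD + wU)
      ≡⟨ cong₂ _+_ (cong₂ _+_ (portWeight-if g (suc j N.<ᵇ n) (hColour i j)) (portWeight-L g i j))
                   (cong₂ _+_ (portWeight-if g (suc i N.<ᵇ m) (vColour i j)) (portWeight-U g i j)) ⟩
    incidentSum (λ i j → g (hColour i j)) (λ i j → g (vColour i j)) i j ∎
    where
    open ≡-Reasoning
    wR = portWeight g (port R i j)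
    wL = portWeight g (port L i j)
    wD = portWeight g (port D i j)
    wU = portWeight g (port U i j)
    regroup : ∀ a b c d → a + (b + (c + (d + 0))) ≡ (a + b) + (c + d)
    regroup = solve-∀

  contains : ℕ → ℕ → ℕ → ℕ
  contains x i j = b2n (memB x (paletteAt i j))

  contains-even : ∀ x → odd (gridSum (contains x)) ≡ false
  contains-even x = trans (cong odd (sum-cong m (λ i p → sum-cong n (λ j q →
              trans (sym (count-distinct x (paletteAt i j) (paletteAt-distinct i j p q))) (sum-palette (isColour x) i j)))))
              (handshake-even (λ i j → isColour x (hColour i j)) (λ i j → isColour x (vColour i j)))

  memB-sameSet : ∀ x l l' → (∀ c → c ∈ l → c ∈ l') → (∀ c → c ∈ l' → c ∈ l) → memB x l ≡ memB x l'
  memB-sameSet x l l' s1 s2 with memB x l in e | memB x l' in e'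
  ... | true | true = refl
  ... | false | false = refl
  ... | true | false = ⊥-elim (subst T e' (memB-complete x l' (s1 x (memB-sound x l (subst T (sym e) tt)))))
  ... | false | true = ⊥-elim (subst T e (memB-complete x l (s2 x (memB-sound x l' (subst T (sym e') tt)))))

  contains-label : ∀ x v w → lb v ≡ lb w → contains x (pi v) (pj v) ≡ contains x (pi w) (pj w)
  contains-label x v w e = cong b2n (memB-sameSet x (P v) (P w) (sameLabel⇒⊆ v w e) (sameLabel⇒⊆ w v (sym e)))

module GridRegions (A B : ℕ) (φ : EdgeColouring (suc (suc (suc A))) (suc (suc (suc B)))) (pr : Proper φ) {k : ℕ}
           (f : Vertex (suc (suc (suc A))) (suc (suc (suc B))) → Fin k)
           (fOK : (x y : Vertex (suc (suc (suc A))) (suc (suc (suc B)))) → (f x ≡ f y) ⇔ SamePalette φ x y) where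
  open PaletteLists (suc (suc A)) (suc (suc B)) φ pr f fOK public
  open Profiles using (odd; b2n; cm; plistB; cm-in; in-cm₁; in-cm₂; memB; memB-sound; memB-complete; plist-in; in-plist)
  open ProfileFacts using (<ᵇ-irr; ≡ᵇ-refl; ≡ᵇ-true)
  open FiniteSums

  MI = suc A
  NI = suc B

  data Corner : ℕ → ℕ → Set where
    c00 : Corner 0 0
    c0n : Corner 0 (suc (suc B))
    cm0 : Corner (suc (suc A)) 0
    cmn : Corner (suc (suc A)) (suc (suc B))

  data Side : ℕ → ℕ → Set where
    top : ∀ t → t < NI → Side 0 (suc t)
    bot : ∀ t → t < NI → Side (suc (suc A)) (suc t)
    lft : ∀ t → t < MI → Side (suc t) 0
    rgt : ∀ t → t < MI → Side (suc t) (suc (suc B))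

  data Interior : ℕ → ℕ → Set where
    int : ∀ i j → i < MI → j < NI → Interior (suc i) (suc j)

  vC : ∀ {i j} → Corner i j → i < m × j < n
  vC c00 = s≤s z≤n , s≤s z≤n
  vC c0n = s≤s z≤n , NP.n<1+n _
  vC cm0 = NP.n<1+n _ , s≤s z≤n
  vC cmn = NP.n<1+n _ , NP.n<1+n _

  vB : ∀ {i j} → Side i j → i < m × j < n
  vB (top t p) = s≤s z≤n , s≤s (NP.m≤n⇒m≤1+n p)
  vB (bot t p) = NP.n<1+n _ , s≤s (NP.m≤n⇒m≤1+n p)
  vB (lft t p) = s≤s (NP.m≤n⇒m≤1+n p) , s≤s z≤n
  vB (rgt t p) = s≤s (NP.m≤n⇒m≤1+n p) , NP.n<1+n _

  vI : ∀ {i j} → Interior i j → i < m × j < n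
  vI (int i j p q) = s≤s (NP.m≤n⇒m≤1+n p) , s≤s (NP.m≤n⇒m≤1+n q)

  posC : ∀ {i j} → Corner i j → Pos
  posC {i} {j} c = pos i j (proj₁ (vC c)) (proj₂ (vC c))
  posB : ∀ {i j} → Side i j → Pos
  posB {i} {j} c = pos i j (proj₁ (vB c)) (proj₂ (vB c))
  posI : ∀ {i j} → Interior i j → Pos
  posI {i} {j} c = pos i j (proj₁ (vI c)) (proj₂ (vI c))

  nzn : ℕ → ℕ
  nzn zero = 0
  nzn (suc _) = 1

  lenCmIf : ∀ b c l → length (cm (if b then just c else nothing) l) ≡ b2n b + length l
  lenCmIf true c l = refl
  lenCmIf false c l = refl

  lenCmL : ∀ i j l → length (cm (port L i j) l) ≡ nzn j + length l
  lenCmL i zero l = refl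
  lenCmL i (suc j) l = refl

  lenCmU : ∀ i j l → length (cm (port U i j) l) ≡ nzn i + length l
  lenCmU zero j l = refl
  lenCmU (suc i) j l = refl

  palette-size : ∀ i j → length (paletteAt i j) ≡ b2n (suc j N.<ᵇ n) + (nzn j + (b2n (suc i N.<ᵇ m) + (nzn i + 0)))
  palette-size i j = trans (lenCmIf (suc j N.<ᵇ n) (hColour i j) _) (cong (b2n (suc j N.<ᵇ n) +_)
               (trans (lenCmL i j _) (cong (nzn j +_) (trans (lenCmIf (suc i N.<ᵇ m) (vColour i j) _)
                 (cong (b2n (suc i N.<ᵇ m) +_) (lenCmU i j []))))))

  corner-size : ∀ {i j} → Corner i j → length (paletteAt i j) ≡ 2
  corner-size c00 = refl
  corner-size c0n rewrite palette-size 0 (suc (suc B)) | <ᵇ-irr B = refl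
  corner-size cm0 rewrite palette-size (suc (suc A)) 0 | <ᵇ-irr A = refl
  corner-size cmn rewrite palette-size (suc (suc A)) (suc (suc B)) | <ᵇ-irr A | <ᵇ-irr B = refl

  side-size : ∀ {i j} → Side i j → length (paletteAt i j) ≡ 3
  side-size (top t p) rewrite palette-size 0 (suc t) | <ᵇ-true p = refl
  side-size (bot t p) rewrite palette-size (suc (suc A)) (suc t) | <ᵇ-true p | <ᵇ-irr A = refl
  side-size (lft t p) rewrite palette-size (suc t) 0 | <ᵇ-true p = refl
  side-size (rgt t p) rewrite palette-size (suc t) (suc (suc B)) | <ᵇ-true p | <ᵇ-irr B = refl

  interior-size : ∀ {i j} → Interior i j → length (paletteAt i j) ≡ 4
  interior-size (int i j p q) rewrite palette-size (suc i) (suc j) | <ᵇ-true p | <ᵇ-true q = refl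

  corner≢side : ∀ {i j i' j'} (c : Corner i j) (b : Side i' j') → labelAt i j ≢ labelAt i' j'
  corner≢side c b = smaller-palette⇒other-label (posC c) (posB b) (subst₂ _<_ (sym (corner-size c)) (sym (side-size b)) (NP.n<1+n 2))
  corner≢interior : ∀ {i j i' j'} (c : Corner i j) (b : Interior i' j') → labelAt i j ≢ labelAt i' j'
  corner≢interior c b = smaller-palette⇒other-label (posC c) (posI b) (subst₂ _<_ (sym (corner-size c)) (sym (interior-size b)) (s≤s (s≤s (s≤s z≤n))))
  side≢interior : ∀ {i j i' j'} (c : Side i j) (b : Interior i' j') → labelAt i j ≢ labelAt i' j'
  side≢interior c b = smaller-palette⇒other-label (posB c) (posI b) (subst₂ _<_ (sym (side-size c)) (sym (interior-size b)) (NP.n<1+n 3))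

  open import Data.Nat.Tactic.RingSolver using (solve-∀)

  cornerSum sideSum interiorSum : (ℕ → ℕ → ℕ) → ℕ
  cornerSum G = G 0 0 + G 0 (suc (suc B)) + G (suc (suc A)) 0 + G (suc (suc A)) (suc (suc B))
  sideSum G = sum NI (λ t → G 0 (suc t)) + sum NI (λ t → G (suc (suc A)) (suc t)) + sum MI (λ t → G (suc t) 0) + sum MI (λ t → G (suc t) (suc (suc B)))
  interiorSum G = sum MI (λ i → sum NI (λ j → G (suc i) (suc j)))

  sum2 : ∀ K g → sum (suc (suc K)) g ≡ g 0 + sum K (λ i → g (suc i)) + g (suc K)
  sum2 K g = trans (cong (g 0 +_) (sum-last K (λ i → g (suc i)))) (sym (NP.+-assoc (g 0) _ _))

  gridSum-regions : ∀ G → gridSum G ≡ cornerSum G + sideSum G + interiorSum G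
  gridSum-regions G =
    trans (sum2 MI (λ i → sum n (λ j → G i j)))
    (trans (cong₂ (λ a b → a + b + sum n (λ j → G (suc MI) j))
                  (sum2 NI (λ j → G 0 j))
                  (trans (sum-cong MI (λ i _ → sum2 NI (λ j → G (suc i) j)))
                    (trans (sum-+ MI (λ i → G (suc i) 0 + sum NI (λ t → G (suc i) (suc t))) (λ i → G (suc i) (suc NI)))
                       (cong (_+ sum MI (λ i → G (suc i) (suc NI))) (sum-+ MI (λ i → G (suc i) 0) (λ i → sum NI (λ t → G (suc i) (suc t))))))))
    (trans (cong (λ a → (G 0 0 + sum NI (λ t → G 0 (suc t)) + G 0 (suc NI)) + (sum MI (λ t → G (suc t) 0) + interiorSum G + sum MI (λ t → G (suc t) (suc NI))) + a) (sum2 NI (λ j → G (suc MI) j)))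
      (lem (G 0 0) (sum NI (λ t → G 0 (suc t))) (G 0 (suc NI))
           (sum MI (λ t → G (suc t) 0)) (interiorSum G) (sum MI (λ t → G (suc t) (suc NI)))
           (G (suc MI) 0) (sum NI (λ t → G (suc MI) (suc t))) (G (suc MI) (suc NI)))))
    where
    lem : ∀ a b c d e f g h i → a + b + c + (d + e + f) + (g + h + i) ≡ a + c + g + i + (b + h + d + f) + e
    lem = solve-∀

  sideSum-cong : ∀ G G' → (∀ i j → Side i j → G i j ≡ G' i j) → sideSum G ≡ sideSum G'
  sideSum-cong G G' h = cong₂ _+_ (cong₂ _+_ (cong₂ _+_ (sum-cong NI (λ t p → h _ _ (top t p))) (sum-cong NI (λ t p → h _ _ (bot t p))))
                                     (sum-cong MI (λ t p → h _ _ (lft t p)))) (sum-cong MI (λ t p → h _ _ (rgt t p)))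

  interiorSum-cong : ∀ G G' → (∀ i j → Interior i j → G i j ≡ G' i j) → interiorSum G ≡ interiorSum G'
  interiorSum-cong G G' h = sum-cong MI (λ i p → sum-cong NI (λ j q → h _ _ (int i j p q)))

  cornerSum-cong : ∀ G G' → (∀ i j → Corner i j → G i j ≡ G' i j) → cornerSum G ≡ cornerSum G'
  cornerSum-cong G G' h = cong₂ _+_ (cong₂ _+_ (cong₂ _+_ (h _ _ c00) (h _ _ c0n)) (h _ _ cm0)) (h _ _ cmn)

  sideSum-+ : ∀ G G' → sideSum (λ i j → G i j + G' i j) ≡ sideSum G + sideSum G'
  sideSum-+ G G' rewrite sum-+ NI (λ t → G 0 (suc t)) (λ t → G' 0 (suc t)) | sum-+ NI (λ t → G (suc (suc A)) (suc t)) (λ t → G' (suc (suc A)) (suc t))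
                      | sum-+ MI (λ t → G (suc t) 0) (λ t → G' (suc t) 0) | sum-+ MI (λ t → G (suc t) (suc (suc B))) (λ t → G' (suc t) (suc (suc B))) =
    lem (sum NI (λ t → G 0 (suc t))) (sum NI (λ t → G' 0 (suc t))) (sum NI (λ t → G (suc (suc A)) (suc t))) (sum NI (λ t → G' (suc (suc A)) (suc t)))
        (sum MI (λ t → G (suc t) 0)) (sum MI (λ t → G' (suc t) 0)) (sum MI (λ t → G (suc t) (suc (suc B)))) (sum MI (λ t → G' (suc t) (suc (suc B))))
    where lem : ∀ a b c d e f g h → a + b + (c + d) + (e + f) + (g + h) ≡ a + c + e + g + (b + d + f + h)
          lem = solve-∀

  sideSum-* : ∀ G t → sideSum (λ i j → G i j * t) ≡ sideSum G * t
  sideSum-* G t rewrite sum-*ʳ NI (λ s → G 0 (suc s)) t | sum-*ʳ NI (λ s → G (suc (suc A)) (suc s)) t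
                     | sum-*ʳ MI (λ s → G (suc s) 0) t | sum-*ʳ MI (λ s → G (suc s) (suc (suc B))) t =
    lem (sum NI (λ s → G 0 (suc s))) (sum NI (λ s → G (suc (suc A)) (suc s))) (sum MI (λ s → G (suc s) 0)) (sum MI (λ s → G (suc s) (suc (suc B)))) t
    where lem : ∀ a b c d t → a * t + b * t + c * t + d * t ≡ (a + b + c + d) * t
          lem = solve-∀

  interiorSum-+ : ∀ G G' → interiorSum (λ i j → G i j + G' i j) ≡ interiorSum G + interiorSum G'
  interiorSum-+ G G' = trans (sum-cong MI (λ i _ → sum-+ NI (λ j → G (suc i) (suc j)) (λ j → G' (suc i) (suc j))))
                        (sum-+ MI (λ i → sum NI (λ j → G (suc i) (suc j))) (λ i → sum NI (λ j → G' (suc i) (suc j))))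

  interiorSum-* : ∀ G t → interiorSum (λ i j → G i j * t) ≡ interiorSum G * t
  interiorSum-* G t = trans (sum-cong MI (λ i _ → sum-*ʳ NI (λ j → G (suc i) (suc j)) t)) (sum-*ʳ MI (λ i → sum NI (λ j → G (suc i) (suc j))) t)

  sideSum-const-even : ∀ t → odd (sideSum (λ _ _ → t)) ≡ false
  sideSum-const-even t rewrite sum-const NI t | sum-const MI t | odd-+ (NI * t + NI * t + MI * t) (MI * t) | odd-+ (NI * t + NI * t) (MI * t) | odd-double (NI * t) with odd (MI * t)
  ... | true = refl
  ... | false = refl

  cornerSum-const-even : ∀ t → odd (cornerSum (λ _ _ → t)) ≡ false
  cornerSum-const-even t rewrite odd-+ (t + t + t) t | odd-+ (t + t) t | odd-double t with odd t
  ... | true = refl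
  ... | false = refl

  interiorSum-ones : interiorSum (λ _ _ → 1) ≡ MI * NI
  interiorSum-ones = trans (sum-cong MI (λ i _ → trans (sum-const NI 1) (NP.*-identityʳ NI))) (sum-const MI NI)

  sideSum-ones : sideSum (λ _ _ → 1) ≡ (NI + NI) + (MI + MI)
  sideSum-ones = trans (cong₂ (λ a b → a + a + b + b) (trans (sum-const NI 1) (NP.*-identityʳ NI)) (trans (sum-const MI 1) (NP.*-identityʳ MI)))
               (NP.+-assoc (NI + NI) MI MI)

  InGrid : ℕ → ℕ → Set
  InGrid i j = i < m × j < n

  sameLabel⇒⊆' : ∀ {i j i' j'} → InGrid i j → InGrid i' j' → labelAt i j ≡ labelAt i' j' → ∀ c → c ∈ paletteAt i j → c ∈ paletteAt i' j'
  sameLabel⇒⊆' (p , q) (p' , q') = sameLabel⇒⊆ (pos _ _ p q) (pos _ _ p' q')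

  contains-sameLabel : ∀ x {i j i' j'} → InGrid i j → InGrid i' j' → labelAt i j ≡ labelAt i' j' → contains x i j ≡ contains x i' j'
  contains-sameLabel x (p , q) (p' , q') = contains-label x (pos _ _ p q) (pos _ _ p' q')

  paletteAt-distinct' : ∀ {i j} → InGrid i j → Distinct (paletteAt i j)
  paletteAt-distinct' (p , q) = paletteAt-distinct _ _ p q

  ports-distinct' : ∀ {i j} → InGrid i j → ∀ d d' {c c'} → d ≢ d' → port d i j ≡ just c → port d' i j ≡ just c' → c ≢ c'
  ports-distinct' {i} {j} (p , q) d d' ne e e' = ports-distinct (fin (suc (suc A)) i) (fin (suc (suc B)) j) d d' ne
    (subst₂ (λ a b → port d a b ≡ just _) (sym (toℕ-fin (suc (suc A)) i p)) (sym (toℕ-fin (suc (suc B)) j q)) e)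
    (subst₂ (λ a b → port d' a b ≡ just _) (sym (toℕ-fin (suc (suc A)) i p)) (sym (toℕ-fin (suc (suc B)) j q)) e')

  port∈paletteAt : ∀ {i j c} d → port d i j ≡ just c → c ∈ paletteAt i j
  port∈paletteAt {i} {j} d e = in-plist (λ d → port d i j) d e

  extendAll : ∀ {K} {Q : ℕ → Set} → (∀ t → t < K → Q t) → Q K → ∀ t → t < suc K → Q t
  extendAll h qK t p with NP.m≤n⇒m<n∨m≡n (NP.≤-pred p)
  ... | inj₁ lt = h t lt
  ... | inj₂ refl = qK

  decideBelow : ∀ K (Q : ℕ → Set) → (∀ t → Dec (Q t)) → (∀ t → t < K → Q t) ⊎ (Σ ℕ λ t → t < K × ¬ Q t)
  decideBelow zero Q dq = inj₁ (λ t ())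
  decideBelow (suc K) Q dq with dq K | decideBelow K Q dq
  ... | no nq | _ = inj₂ (K , NP.n<1+n K , nq)
  ... | yes _ | inj₂ (t , p , nq) = inj₂ (t , NP.m≤n⇒m≤1+n p , nq)
  ... | yes qK | inj₁ h = inj₁ (extendAll h qK)

  Counterexample : (ℕ → ℕ → Set) → (ℕ → ℕ → Set) → Set
  Counterexample C Q = Σ ℕ λ i → Σ ℕ λ j → C i j × ¬ Q i j

  decideSides : (Q : ℕ → ℕ → Set) → (∀ i j → Dec (Q i j)) → (∀ i j → Side i j → Q i j) ⊎ Counterexample Side Q
  decideSides Q dq with decideBelow NI (λ t → Q 0 (suc t)) (λ t → dq _ _) | decideBelow NI (λ t → Q (suc (suc A)) (suc t)) (λ t → dq _ _)
                 | decideBelow MI (λ t → Q (suc t) 0) (λ t → dq _ _) | decideBelow MI (λ t → Q (suc t) (suc (suc B))) (λ t → dq _ _)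
  ... | inj₂ (t , p , nq) | _ | _ | _ = inj₂ (_ , _ , top t p , nq)
  ... | inj₁ _ | inj₂ (t , p , nq) | _ | _ = inj₂ (_ , _ , bot t p , nq)
  ... | inj₁ _ | inj₁ _ | inj₂ (t , p , nq) | _ = inj₂ (_ , _ , lft t p , nq)
  ... | inj₁ _ | inj₁ _ | inj₁ _ | inj₂ (t , p , nq) = inj₂ (_ , _ , rgt t p , nq)
  ... | inj₁ h1 | inj₁ h2 | inj₁ h3 | inj₁ h4 = inj₁ λ { _ _ (top t p) → h1 t p ; _ _ (bot t p) → h2 t p ; _ _ (lft t p) → h3 t p ; _ _ (rgt t p) → h4 t p }

  decideInterior : (Q : ℕ → ℕ → Set) → (∀ i j → Dec (Q i j)) → (∀ i j → Interior i j → Q i j) ⊎ Counterexample Interior Q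
  decideInterior Q dq with decideBelow MI (λ i → ∀ j → j < NI → Q (suc i) (suc j)) dqi
    where dqi : ∀ i → Dec (∀ j → j < NI → Q (suc i) (suc j))
          dqi i with decideBelow NI (λ j → Q (suc i) (suc j)) (λ j → dq _ _)
          ... | inj₁ h = yes h
          ... | inj₂ (j , q , nq) = no λ h → nq (h j q)
  ... | inj₁ h = inj₁ λ { _ _ (int i j p q) → h i p j q }
  ... | inj₂ (i , p , nh) with decideBelow NI (λ j → Q (suc i) (suc j)) (λ j → dq _ _)
  ... | inj₁ h = ⊥-elim (nh h)
  ... | inj₂ (j , q , nq) = inj₂ (_ , _ , int i j p q , nq)

  decideCorners : (Q : ℕ → ℕ → Set) → (∀ i j → Dec (Q i j)) → (∀ i j → Corner i j → Q i j) ⊎ Counterexample Corner Q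
  decideCorners Q dq with dq 0 0 | dq 0 (suc (suc B)) | dq (suc (suc A)) 0 | dq (suc (suc A)) (suc (suc B))
  ... | no nq | _ | _ | _ = inj₂ (_ , _ , c00 , nq)
  ... | yes _ | no nq | _ | _ = inj₂ (_ , _ , c0n , nq)
  ... | yes _ | yes _ | no nq | _ = inj₂ (_ , _ , cm0 , nq)
  ... | yes _ | yes _ | yes _ | no nq = inj₂ (_ , _ , cmn , nq)
  ... | yes h1 | yes h2 | yes h3 | yes h4 = inj₁ λ { _ _ c00 → h1 ; _ _ c0n → h2 ; _ _ cm0 → h3 ; _ _ cmn → h4 }

  palette-neighbour : ∀ i j y → InGrid i j → y ∈ paletteAt i j →
    (suc j < n × y ∈ paletteAt i (suc j)) ⊎ (Σ ℕ λ j' → j ≡ suc j' × y ∈ paletteAt i j') ⊎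
    (suc i < m × y ∈ paletteAt (suc i) j) ⊎ (Σ ℕ λ i' → i ≡ suc i' × y ∈ paletteAt i' j)
  palette-neighbour i j y v yin with plist-in (λ d → port d i j) yin
  ... | R , e = let (q , h) = portR-just i j e in inj₁ (q , port∈paletteAt {i} {suc j} L (cong just h))
  ... | D , e = let (q , h) = portD-just i j e in inj₂ (inj₂ (inj₁ (q , port∈paletteAt {suc i} {j} U (cong just h))))
  palette-neighbour i (suc j') y v yin | L , e = inj₂ (inj₁ (j' , refl , port∈paletteAt {i} {j'} R (trans (portR-yes i j' (proj₂ v)) e)))
  palette-neighbour (suc i') j y v yin | U , e = inj₂ (inj₂ (inj₂ (i' , refl , port∈paletteAt {i'} {j} D (trans (portD-yes i' j (proj₁ v)) e))))

  -- Both neighbours of a corner are side vertices.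
  corner-colour-on-side : ∀ {i j} → Corner i j → ∀ y → y ∈ paletteAt i j → Σ ℕ λ i' → Σ ℕ λ j' → Side i' j' × y ∈ paletteAt i' j'
  corner-colour-on-side c y yin with palette-neighbour _ _ y (vC c) yin
  corner-colour-on-side c00 y yin | inj₁ (_ , h) = _ , _ , top 0 (s≤s z≤n) , h
  corner-colour-on-side c00 y yin | inj₂ (inj₁ (_ , () , _))
  corner-colour-on-side c00 y yin | inj₂ (inj₂ (inj₁ (_ , h))) = _ , _ , lft 0 (s≤s z≤n) , h
  corner-colour-on-side c00 y yin | inj₂ (inj₂ (inj₂ (_ , () , _)))
  corner-colour-on-side c0n y yin | inj₁ (q , _) = ⊥-elim (NP.<-irrefl refl q)
  corner-colour-on-side c0n y yin | inj₂ (inj₁ (_ , refl , h)) = _ , _ , top B (NP.n<1+n B) , h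
  corner-colour-on-side c0n y yin | inj₂ (inj₂ (inj₁ (_ , h))) = _ , _ , rgt 0 (s≤s z≤n) , h
  corner-colour-on-side c0n y yin | inj₂ (inj₂ (inj₂ (_ , () , _)))
  corner-colour-on-side cm0 y yin | inj₁ (_ , h) = _ , _ , bot 0 (s≤s z≤n) , h
  corner-colour-on-side cm0 y yin | inj₂ (inj₁ (_ , () , _))
  corner-colour-on-side cm0 y yin | inj₂ (inj₂ (inj₁ (q , _))) = ⊥-elim (NP.<-irrefl refl q)
  corner-colour-on-side cm0 y yin | inj₂ (inj₂ (inj₂ (_ , refl , h))) = _ , _ , lft A (NP.n<1+n A) , h
  corner-colour-on-side cmn y yin | inj₁ (q , _) = ⊥-elim (NP.<-irrefl refl q)
  corner-colour-on-side cmn y yin | inj₂ (inj₁ (_ , refl , h)) = _ , _ , bot B (NP.n<1+n B) , h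
  corner-colour-on-side cmn y yin | inj₂ (inj₂ (inj₁ (q , _))) = ⊥-elim (NP.<-irrefl refl q)
  corner-colour-on-side cmn y yin | inj₂ (inj₂ (inj₂ (_ , refl , h))) = _ , _ , rgt A (NP.n<1+n A) , h

  contains-regions-even : ∀ x → odd (cornerSum (contains x) + sideSum (contains x) + interiorSum (contains x)) ≡ false
  contains-regions-even x = trans (cong odd (sym (gridSum-regions (contains x)))) (contains-even x)

module CountLabels where
  open import Data.List using (allFin)
  open import Data.List.Properties using (length-tabulate)
  open import Data.List.Membership.Propositional.Properties using (∈-allFin)

  finBound : ∀ {k} (l : List (Fin k)) → Distinct l → length l ≤ k
  finBound {k} l u = subst (length l ≤_) (length-tabulate {n = k} (λ i → i)) (distinct-length-≤ l (allFin k) u (λ {z} _ → ∈-allFin z))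

  two : ∀ {k} {a b : Fin k} → a ≢ b → 2 ≤ k
  two {a = a} {b} ab = finBound (a ∷ b ∷ []) (∉-singleton ab ∷ᵘ ((λ ()) ∷ᵘ []ᵘ))

  three : ∀ {k} {a b c : Fin k} → a ≢ b → a ≢ c → b ≢ c → 3 ≤ k
  three {a = a} {b} {c} ab ac bc = finBound (a ∷ b ∷ c ∷ []) (∉-∷ ab (∉-singleton ac) ∷ᵘ (∉-singleton bc ∷ᵘ ((λ ()) ∷ᵘ []ᵘ)))

  five : ∀ {k} {a b c d e : Fin k} → a ≢ b → a ≢ c → a ≢ d → a ≢ e → b ≢ c → b ≢ d → b ≢ e → c ≢ d → c ≢ e → d ≢ e → 5 ≤ k
  five {a = a} {b} {c} {d} {e} ab ac ad ae bc bd be cd ce de =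
    finBound (a ∷ b ∷ c ∷ d ∷ e ∷ [])
      (∉-∷ ab (∉-∷ ac (∉-∷ ad (∉-singleton ae))) ∷ᵘ (∉-∷ bc (∉-∷ bd (∉-singleton be)) ∷ᵘ (∉-∷ cd (∉-singleton ce) ∷ᵘ (∉-singleton de ∷ᵘ ((λ ()) ∷ᵘ []ᵘ)))))
-- Pure list reasoning behind the side case of the five-palette bound.  Let
-- PA, PB (3 colours) be the two side palettes and P4 (4 colours) the interior
-- palette, related as the parity argument forces: colours of P4 lie in exactly
-- one of PA, PB, and colours outside P4 lie in both or neither.  Then at a side
-- vertex with palette PA whose third colour d also lies in P4, exactly one of
-- its two side colours r1, r2 lies in P4.

module SideRing (PA PB P4 : List ℕ) (uA : Distinct PA) (uB : Distinct PB) (u4 : Distinct P4)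
             (lA : length PA ≡ 3) (lB : length PB ≡ 3) (l4 : length P4 ≡ 4)
             (E1a : ∀ x → x ∈ P4 → x ∈ PA → x ∉ PB) (E1b : ∀ x → x ∈ P4 → x ∈ PA ⊎ x ∈ PB)
             (E2 : ∀ y → y ∉ P4 → y ∈ PA → y ∈ PB) (E2' : ∀ y → y ∉ P4 → y ∈ PB → y ∈ PA) where
  open import Data.List.Membership.DecPropositional N._≟_ using (_∈?_)

  6≰4 : 6 ≤ 4 → ⊥
  6≰4 (s≤s (s≤s (s≤s (s≤s ()))))

  in3 : ∀ {r1 r2 d} → r1 ≢ r2 → r1 ≢ d → r2 ≢ d → r1 ∈ PA → r2 ∈ PA → d ∈ PA → ∀ b → b ∈ PA → b ≡ r1 ⊎ b ≡ r2 ⊎ b ≡ d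
  in3 {r1} {r2} {d} n12 n1d n2d m1 m2 md b bA with b N.≟ r1 | b N.≟ r2 | b N.≟ d
  ... | yes e | _ | _ = inj₁ e
  ... | no _ | yes e | _ = inj₂ (inj₁ e)
  ... | no _ | no _ | yes e = inj₂ (inj₂ e)
  ... | no b1 | no b2 | no bd =
    ⊥-elim (NP.n≮n _ (subst (4 ≤_) lA (distinct-length-≤ (b ∷ r1 ∷ r2 ∷ d ∷ []) PA
      (∉-∷ b1 (∉-∷ b2 (∉-singleton bd)) ∷ᵘ (∉-∷ n12 (∉-singleton n1d) ∷ᵘ (∉-singleton n2d ∷ᵘ ((λ ()) ∷ᵘ []ᵘ))))
      (λ { (here refl) → bA ; (there (here refl)) → m1 ; (there (there (here refl))) → m2 ; (there (there (there (here refl)))) → md ; (there (there (there (there ())))) }))))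

  -- If both r1, r2 were in P4, then r1, r2, d and PB would give five colours
  -- of P4; if neither were, r1, r2 and P4 would give six colours of d ∷ PB.
  ring : ∀ {r1 r2 d} → r1 ≢ r2 → r1 ≢ d → r2 ≢ d → r1 ∈ PA → r2 ∈ PA → d ∈ PA → d ∈ P4 →
         (r1 ∈ P4 × r2 ∉ P4) ⊎ (r1 ∉ P4 × r2 ∈ P4)
  ring {r1} {r2} {d} n12 n1d n2d m1 m2 md d4 with r1 ∈? P4 | r2 ∈? P4
  ... | yes h1 | no h2 = inj₁ (h1 , h2)
  ... | no h1 | yes h2 = inj₂ (h1 , h2)
  ... | yes h1 | yes h2 =
    ⊥-elim (6≰4 (subst₂ _≤_ (cong (λ z → suc (suc (suc z))) lB) l4 (distinct-length-≤ (r1 ∷ r2 ∷ d ∷ PB) P4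
      (∉-∷ n12 (∉-∷ n1d (E1a r1 h1 m1)) ∷ᵘ (∉-∷ n2d (E1a r2 h2 m2) ∷ᵘ (E1a d d4 md ∷ᵘ uB)))
      sub)))
    where
    sub : ∀ {z} → z ∈ r1 ∷ r2 ∷ d ∷ PB → z ∈ P4
    sub (here refl) = h1
    sub (there (here refl)) = h2
    sub (there (there (here refl))) = d4
    sub {z} (there (there (there zB))) with z ∈? P4
    ... | yes z4 = z4
    ... | no nz with in3 n12 n1d n2d m1 m2 md z (E2' z nz zB)
    ... | inj₁ refl = h1
    ... | inj₂ (inj₁ refl) = h2
    ... | inj₂ (inj₂ refl) = d4
  ... | no h1 | no h2 =
    ⊥-elim (6≰4 (subst₂ _≤_ (cong (λ z → suc (suc z)) l4) (cong suc lB) (distinct-length-≤ (r1 ∷ r2 ∷ P4) (d ∷ PB)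
      (∉-∷ n12 h1 ∷ᵘ (h2 ∷ᵘ u4)) sub)))
    where
    sub : ∀ {z} → z ∈ r1 ∷ r2 ∷ P4 → z ∈ d ∷ PB
    sub (here refl) = there (E2 r1 h1 m1)
    sub (there (here refl)) = there (E2 r2 h2 m2)
    sub {z} (there (there z4)) with E1b z z4
    ... | inj₂ zB = there zB
    ... | inj₁ zA with in3 n12 n1d n2d m1 m2 md z zA
    ... | inj₁ refl = ⊥-elim (h1 z4)
    ... | inj₂ (inj₁ refl) = ⊥-elim (h2 z4)
    ... | inj₂ (inj₂ refl) = here refl

-- The lower bound 5 for odd grids G(A+3,B+3) (A+1, B+1 odd, so the interior
-- has an odd number (A+1)(B+1) of vertices).  Corners, sides and interior use
-- at least one palette each; the only ways to use at most four in total are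
-- excluded by parity, applied to the handshake count of a suitable colour x:
--  * sides and interior each uniform: a colour of the interior palette that
--    is not on the side palette would occur an odd number of times;
--  * corners and sides uniform, interior with exactly two palettes a, b:
--    comparing the counts of a colour of a and of a colour of b forces the
--    numbers of a- and b-vertices to be both even, contradicting their odd sum;
--  * corners and interior uniform, sides with exactly two palettes: the
--    'SideRing' lemma and a handshake count over the boundary cycle.

module AtLeastFive (A B : ℕ) (φ : EdgeColouring (suc (suc (suc A))) (suc (suc (suc B)))) (pr : Proper φ) {k : ℕ}
           (f : Vertex (suc (suc (suc A))) (suc (suc (suc B))) → Fin k)
           (fOK : (x y : Vertex (suc (suc (suc A))) (suc (suc (suc B)))) → (f x ≡ f y) ⇔ SamePalette φ x y)
           (oA : Profiles.odd (suc A) ≡ true) (oB : Profiles.odd (suc B) ≡ true) where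
  open GridRegions A B φ pr f fOK
  open Profiles using (odd; b2n; memB; memB-sound; memB-complete)
  open FiniteSums
  open import Data.Bool.Properties using (∧-identityʳ; ∧-zeroʳ)

  interior₁₁ : Interior 1 1
  interior₁₁ = int 0 0 (s≤s z≤n) (s≤s z≤n)
  side₀₁ : Side 0 1
  side₀₁ = top 0 (s≤s z≤n)

  T→≡ : ∀ {b} → T b → b ≡ true
  T→≡ {true} _ = refl

  par3 : ∀ a b c → odd (a + b + c) ≡ xor (xor (odd a) (odd b)) (odd c)
  par3 a b c rewrite odd-+ (a + b) c | odd-+ a b = refl

  oddMN : odd (MI * NI) ≡ true
  oddMN rewrite odd-* MI NI | oA | oB = refl

  memT : ∀ x l → x ∈ l → memB x l ≡ true
  memT x l h = T→≡ (memB-complete x l h)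

  -- The interior palette (4
  -- colours) cannot lie inside the side palette (3 colours); but a colour x of
  -- the interior palette missing from the side palette is on no corner either
  -- (corners only touch sides), so it would occur an odd number (A+1)(B+1) of
  -- times, against the handshake parity.
  uniform-regions-impossible : (∀ i j → Side i j → labelAt i j ≡ labelAt 0 1) →
    (∀ i j → Interior i j → labelAt i j ≡ labelAt 1 1) → ⊥
  uniform-regions-impossible BU IU =
    NP.<-irrefl refl (subst₂ _≤_ (interior-size interior₁₁) (side-size side₀₁)
      (distinct-length-≤ (paletteAt 1 1) (paletteAt 0 1) (paletteAt-distinct' (vI interior₁₁)) (λ {x} → interior⊆side x)))
    where
    oddCount : ∀ x → x ∈ paletteAt 1 1 → memB x (paletteAt 0 1) ≡ false →
      odd (cornerSum (contains x) + sideSum (contains x) + interiorSum (contains x)) ≡ true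
    oddCount x xin notSide = begin
      odd (cornerSum (contains x) + sideSum (contains x) + interiorSum (contains x))
        ≡⟨ par3 (cornerSum (contains x)) (sideSum (contains x)) (interiorSum (contains x)) ⟩
      xor (xor (odd (cornerSum (contains x))) (odd (sideSum (contains x)))) (odd (interiorSum (contains x)))
        ≡⟨ cong₂ (λ u v → xor (xor u v) (odd (interiorSum (contains x)))) cornersEven sidesEven ⟩
      odd (interiorSum (contains x))
        ≡⟨ cong odd interiorAll ⟩
      odd (MI * NI)
        ≡⟨ oddMN ⟩
      true ∎
      where
      open ≡-Reasoning
      sidesEven : odd (sideSum (contains x)) ≡ false
      sidesEven = trans (cong odd (sideSum-cong (contains x) (λ _ _ → contains x 0 1)
                    (λ i j b → contains-sameLabel x (vB b) (vB side₀₁) (BU i j b)))) (sideSum-const-even (contains x 0 1))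
      interiorAll : interiorSum (contains x) ≡ MI * NI
      interiorAll = trans (interiorSum-cong (contains x) (λ _ _ → 1)
                      (λ i j c → trans (contains-sameLabel x (vI c) (vI interior₁₁) (IU i j c)) (cong b2n (memT x _ xin))))
                      interiorSum-ones
      notOnCorner : ∀ i j → Corner i j → contains x i j ≡ 0
      notOnCorner i j c with memB x (paletteAt i j) in onCorner
      ... | false = refl
      ... | true with corner-colour-on-side c x (memB-sound x _ (subst T (sym onCorner) tt))
      ... | i' , j' , bb , h = ⊥-elim (subst T notSide (memB-complete x _ (sameLabel⇒⊆' (vB bb) (vB side₀₁) (BU i' j' bb) x h)))
      cornersEven : odd (cornerSum (contains x)) ≡ false
      cornersEven = cong odd (cornerSum-cong (contains x) (λ _ _ → 0) notOnCorner)
    interior⊆side : ∀ x → x ∈ paletteAt 1 1 → x ∈ paletteAt 0 1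
    interior⊆side x xin with memB x (paletteAt 0 1) in onSide
    ... | true = memB-sound x (paletteAt 0 1) (subst T (sym onSide) tt)
    ... | false = case trans (sym (oddCount x xin onSide)) (contains-regions-even x) of λ ()

  isL : Fin k → ℕ → ℕ → ℕ
  isL ℓ i j = b2n (does (labelAt i j FP.≟ ℓ))

  isL-yes : ∀ {ℓ i j} → labelAt i j ≡ ℓ → isL ℓ i j ≡ 1
  isL-yes {ℓ} {i} {j} e with labelAt i j FP.≟ ℓ
  ... | yes _ = refl
  ... | no ne = ⊥-elim (ne e)

  isL-no : ∀ {ℓ i j} → labelAt i j ≢ ℓ → isL ℓ i j ≡ 0
  isL-no {ℓ} {i} {j} ne with labelAt i j FP.≟ ℓ
  ... | yes e = ⊥-elim (ne e)
  ... | no _ = refl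

  split2 : ∀ {ℓa ℓb i j} (G : ℕ → ℕ → ℕ) ta tb → ℓa ≢ ℓb → (labelAt i j ≡ ℓa → G i j ≡ ta) → (labelAt i j ≡ ℓb → G i j ≡ tb) →
           (labelAt i j ≡ ℓa ⊎ labelAt i j ≡ ℓb) → G i j ≡ isL ℓa i j * ta + isL ℓb i j * tb
  split2 {ℓa} {ℓb} {i} {j} G ta tb nab ha hb (inj₁ e) rewrite isL-yes {ℓa} {i} {j} e | isL-no {ℓb} {i} {j} (λ e' → nab (trans (sym e) e')) =
    trans (ha e) (sym (trans (NP.+-identityʳ (ta + 0)) (NP.+-identityʳ ta)))
  split2 {ℓa} {ℓb} {i} {j} G ta tb nab ha hb (inj₂ e) rewrite isL-yes {ℓb} {i} {j} e | isL-no {ℓa} {i} {j} (λ e' → nab (trans (sym e') e)) =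
    trans (hb e) (sym (NP.+-identityʳ tb))

  sum1 : ∀ {ℓa ℓb i j} → ℓa ≢ ℓb → (labelAt i j ≡ ℓa ⊎ labelAt i j ≡ ℓb) → isL ℓa i j + isL ℓb i j ≡ 1
  sum1 {ℓa} {ℓb} {i} {j} nab (inj₁ e) rewrite isL-yes {ℓa} {i} {j} e | isL-no {ℓb} {i} {j} (λ e' → nab (trans (sym e) e')) = refl
  sum1 {ℓa} {ℓb} {i} {j} nab (inj₂ e) rewrite isL-yes {ℓb} {i} {j} e | isL-no {ℓa} {i} {j} (λ e' → nab (trans (sym e') e)) = refl

  oddb2n : ∀ b → odd (b2n b) ≡ b
  oddb2n true = refl
  oddb2n false = refl

  intR : ∀ {i j} → Interior i j → suc j < n
  intR (int i j p q) = s≤s (s≤s q)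

  DxOne : ∀ x i j → x ∈ paletteAt i j → contains x i j ≡ 1
  DxOne x i j h = cong b2n (memT x _ h)

  two-interior-palettes-impossible : (∀ i j → Side i j → labelAt i j ≡ labelAt 0 1) → (∀ i j → Corner i j → labelAt i j ≡ labelAt 0 0) →
           ∀ iw jw → Interior iw jw → labelAt iw jw ≢ labelAt 1 1 →
           (∀ i j → Interior i j → labelAt i j ≡ labelAt 1 1 ⊎ labelAt i j ≡ labelAt iw jw) → ⊥
  two-interior-palettes-impossible BU CU iw jw cw ne two = fin2 (odd a) eqX eqY abOdd
    where
    ℓa = labelAt 1 1
    ℓb = labelAt iw jw
    nab : ℓa ≢ ℓb
    nab e = ne (sym e)
    a = interiorSum (isL ℓa)
    b = interiorSum (isL ℓb)
    -- With uniform corners and sides, every colour occurs an even number of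
    -- times in the interior.
    intOdd : ∀ x → odd (interiorSum (contains x)) ≡ false
    intOdd x = trans (sym (trans (par3 (cornerSum (contains x)) (sideSum (contains x)) (interiorSum (contains x)))
                 (cong₂ (λ u v → xor (xor u v) (odd (interiorSum (contains x)))) cE bE))) (contains-regions-even x)
      where
      cE : odd (cornerSum (contains x)) ≡ false
      cE = trans (cong odd (cornerSum-cong (contains x) (λ _ _ → contains x 0 0) (λ i j c → contains-sameLabel x (vC c) (vC c00) (CU i j c)))) (cornerSum-const-even (contains x 0 0))
      bE : odd (sideSum (contains x)) ≡ false
      bE = trans (cong odd (sideSum-cong (contains x) (λ _ _ → contains x 0 1) (λ i j c → contains-sameLabel x (vB c) (vB side₀₁) (BU i j c)))) (sideSum-const-even (contains x 0 1))
    intSplit : ∀ x → interiorSum (contains x) ≡ a * contains x 1 1 + b * contains x iw jw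
    intSplit x = trans (interiorSum-cong (contains x) (λ i j → isL ℓa i j * contains x 1 1 + isL ℓb i j * contains x iw jw)
                   (λ i j c → split2 (contains x) (contains x 1 1) (contains x iw jw) nab (contains-sameLabel x (vI c) (vI interior₁₁)) (contains-sameLabel x (vI c) (vI cw)) (two i j c)))
                 (trans (interiorSum-+ (λ i j → isL ℓa i j * contains x 1 1) (λ i j → isL ℓb i j * contains x iw jw))
                   (cong₂ _+_ (interiorSum-* (isL ℓa) (contains x 1 1)) (interiorSum-* (isL ℓb) (contains x iw jw))))
    eqGen : ∀ x → xor (odd a ∧ odd (contains x 1 1)) (odd b ∧ odd (contains x iw jw)) ≡ false
    eqGen x = trans (sym (trans (odd-+ (a * contains x 1 1) (b * contains x iw jw)) (cong₂ xor (odd-* a _) (odd-* b _))))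
                (trans (cong odd (sym (intSplit x))) (intOdd x))
    abOdd : xor (odd a) (odd b) ≡ true
    abOdd = trans (sym (odd-+ a b)) (trans (cong odd (trans (sym (interiorSum-+ (isL ℓa) (isL ℓb)))
              (trans (interiorSum-cong _ (λ _ _ → 1) (λ i j c → sum1 nab (two i j c))) interiorSum-ones))) oddMN)
    x0 = hColour 1 1
    y0 = hColour iw jw
    eqX : xor (odd a) (odd b ∧ odd (contains x0 iw jw)) ≡ false
    eqX = trans (cong (λ t → xor t (odd b ∧ odd (contains x0 iw jw))) (sym (∧-identityʳ (odd a))))
            (trans (cong (λ t → xor (odd a ∧ t) (odd b ∧ odd (contains x0 iw jw))) (sym (cong odd (DxOne x0 1 1 (here refl))))) (eqGen x0))
    eqY : xor (odd a ∧ odd (contains y0 1 1)) (odd b) ≡ false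
    eqY = trans (cong (λ t → xor (odd a ∧ odd (contains y0 1 1)) t) (sym (∧-identityʳ (odd b))))
            (trans (cong (λ t → xor (odd a ∧ odd (contains y0 1 1)) (odd b ∧ t)) (sym (cong odd (DxOne y0 iw jw (port∈paletteAt R (portR-yes iw jw (intR cw)))))))
              (eqGen y0))
    -- Evaluated at a colour of a and at a colour of b, the parity equation
    -- forbids a + b odd.
    fin2 : ∀ α → xor α (odd b ∧ odd (contains x0 iw jw)) ≡ false → xor (α ∧ odd (contains y0 1 1)) (odd b) ≡ false → xor α (odd b) ≡ true → ⊥
    fin2 true e1 e2 e3 with odd b
    ... | true = case e3 of λ ()
    ... | false = case e1 of λ ()
    fin2 false e1 e2 e3 with odd b
    ... | true = case e2 of λ ()
    ... | false = case e3 of λ ()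

  open ListSums using (sumL; sameSum)

  xorF : ∀ u v → xor u v ≡ false → u ≡ v
  xorF true true _ = refl
  xorF false false _ = refl

  ≡ᵇ-lt : ∀ {i K} → i < K → (i N.≡ᵇ K) ≡ false
  ≡ᵇ-lt {i} {K} p with i N.≡ᵇ K in e
  ... | false = refl
  ... | true = ⊥-elim (NP.<-irrefl (ProfileFacts.≡ᵇ-true i K e) p)

  ifz : ∀ b → (if b then 0 else 0) ≡ 0
  ifz true = refl
  ifz false = refl

  bOA : ∀ oa ob p q → ob ≡ oa → xor (oa ∧ p) (ob ∧ q) ≡ true → oa ≡ true
  bOA true _ _ _ _ _ = refl
  bOA false .false _ _ refl ()

  bE1a : ∀ {p q r} → xor p q ≡ r → r ≡ true → p ≡ true → q ≡ true → ⊥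
  bE1a {true} {true} {r} e er refl refl with trans e er
  ... | ()

  bE1b : ∀ {p q r} → xor p q ≡ r → r ≡ true → p ≡ false → q ≡ true
  bE1b {false} e er refl = trans e er

  bE2 : ∀ {p q r} → xor p q ≡ r → r ≡ false → p ≡ true → q ≡ true
  bE2 {true} {true} e er refl = refl
  bE2 {true} {false} e er refl with trans e er
  ... | ()

  bE2' : ∀ {p q r} → xor p q ≡ r → r ≡ false → q ≡ true → p ≡ true
  bE2' {true} {true} e er refl = refl
  bE2' {false} {true} e er refl with trans e er
  ... | ()

  gval : ∀ {a1 b1 a2 b2} → a1 ≡ true → a2 ≡ true → (b1 ≡ true × b2 ≡ false) ⊎ (b1 ≡ false × b2 ≡ true) →
         b2n (a1 ∧ b1) + b2n (a2 ∧ b2) ≡ 1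
  gval refl refl (inj₁ (refl , refl)) = refl
  gval refl refl (inj₂ (refl , refl)) = refl

  bcase : ∀ b → (b ≡ true) ⊎ (b ≡ false)
  bcase true = inj₁ refl
  bcase false = inj₂ refl

  -- Parity forces the hypotheses of 'SideRing'; then the colours of PA ∩ P4
  -- on boundary edges form a weight whose handshake count is odd.
  module TwoSidePalettes (IU : ∀ i j → Interior i j → labelAt i j ≡ labelAt 1 1) (CU : ∀ i j → Corner i j → labelAt i j ≡ labelAt 0 0)
            (ib jb : ℕ) (cb : Side ib jb) (neB : labelAt ib jb ≢ labelAt 0 1)
            (two : ∀ i j → Side i j → labelAt i j ≡ labelAt 0 1 ⊎ labelAt i j ≡ labelAt ib jb) where
    ℓA = labelAt 0 1
    ℓB = labelAt ib jb
    nAB : ℓA ≢ ℓB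
    nAB e = neB (sym e)
    PA = paletteAt 0 1
    PB = paletteAt ib jb
    P4 = paletteAt 1 1
    a = sideSum (isL ℓA)
    b = sideSum (isL ℓB)

    -- a, b: the numbers of side vertices with palette PA resp. PB; their sum
    -- 2(A+1) + 2(B+1) is even.
    abEven : odd (a + b) ≡ false
    abEven = trans (cong odd (trans (sym (sideSum-+ (isL ℓA) (isL ℓB)))
               (trans (sideSum-cong _ (λ _ _ → 1) (λ i j c → sum1 nAB (two i j c))) sideSum-ones)))
               (trans (odd-+ (NI + NI) (MI + MI)) (cong₂ xor (odd-double NI) (odd-double MI)))

    obEq : odd b ≡ odd a
    obEq = sym (xorF (odd a) (odd b) (trans (sym (odd-+ a b)) abEven))

    bndSplit : ∀ x → sideSum (contains x) ≡ a * contains x 0 1 + b * contains x ib jb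
    bndSplit x = trans (sideSum-cong (contains x) (λ i j → isL ℓA i j * contains x 0 1 + isL ℓB i j * contains x ib jb)
                   (λ i j c → split2 (contains x) (contains x 0 1) (contains x ib jb) nAB (contains-sameLabel x (vB c) (vB side₀₁)) (contains-sameLabel x (vB c) (vB cb)) (two i j c)))
                 (trans (sideSum-+ (λ i j → isL ℓA i j * contains x 0 1) (λ i j → isL ℓB i j * contains x ib jb))
                   (cong₂ _+_ (sideSum-* (isL ℓA) (contains x 0 1)) (sideSum-* (isL ℓB) (contains x ib jb))))

    intC : ∀ x → interiorSum (contains x) ≡ MI * (NI * contains x 1 1)
    intC x = trans (interiorSum-cong (contains x) (λ _ _ → contains x 1 1) (λ i j c → contains-sameLabel x (vI c) (vI interior₁₁) (IU i j c)))
               (trans (sum-cong MI (λ _ _ → sum-const NI (contains x 1 1))) (sum-const MI (NI * contains x 1 1)))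

    corE : ∀ x → odd (cornerSum (contains x)) ≡ false
    corE x = trans (cong odd (cornerSum-cong (contains x) (λ _ _ → contains x 0 0) (λ i j c → contains-sameLabel x (vC c) (vC c00) (CU i j c)))) (cornerSum-const-even (contains x 0 0))

    eqGen : ∀ x → xor (odd a ∧ memB x PA) (odd b ∧ memB x PB) ≡ memB x P4
    eqGen x = trans (sym oddB) (trans (xorF _ _ sidesVsInterior) oddI)
      where
      open ≡-Reasoning
      sidesVsInterior : xor (odd (sideSum (contains x))) (odd (interiorSum (contains x))) ≡ false
      sidesVsInterior = begin
        xor (odd (sideSum (contains x))) (odd (interiorSum (contains x)))
          ≡⟨ cong (λ u → xor (xor u (odd (sideSum (contains x)))) (odd (interiorSum (contains x)))) (sym (corE x)) ⟩
        xor (xor (odd (cornerSum (contains x))) (odd (sideSum (contains x)))) (odd (interiorSum (contains x)))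
          ≡⟨ sym (par3 (cornerSum (contains x)) (sideSum (contains x)) (interiorSum (contains x))) ⟩
        odd (cornerSum (contains x) + sideSum (contains x) + interiorSum (contains x))
          ≡⟨ contains-regions-even x ⟩
        false ∎
      oddB : odd (sideSum (contains x)) ≡ xor (odd a ∧ memB x PA) (odd b ∧ memB x PB)
      oddB = trans (cong odd (bndSplit x)) (trans (odd-+ (a * contains x 0 1) (b * contains x ib jb))
               (cong₂ xor (trans (odd-* a (contains x 0 1)) (cong (odd a ∧_) (oddb2n (memB x PA)))) (trans (odd-* b (contains x ib jb)) (cong (odd b ∧_) (oddb2n (memB x PB))))))
      oddI : odd (interiorSum (contains x)) ≡ memB x P4
      oddI = trans (cong odd (intC x)) (trans (odd-* MI (NI * contains x 1 1)) (trans (cong (odd MI ∧_) (odd-* NI (contains x 1 1)))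
               (trans (cong₂ (λ u v → u ∧ (v ∧ odd (contains x 1 1))) oA oB) (oddb2n (memB x P4)))))

    -- A colour of P4 shows that a (and with it b) is odd.
    oaT : odd a ≡ true
    oaT = bOA (odd a) (odd b) (memB (hColour 1 1) PA) (memB (hColour 1 1) PB) obEq (trans (eqGen (hColour 1 1)) (memT (hColour 1 1) P4 (here refl)))

    obT : odd b ≡ true
    obT = trans obEq oaT

    eqAB : ∀ x → xor (memB x PA) (memB x PB) ≡ memB x P4
    eqAB x = trans (cong₂ (λ u v → xor (u ∧ memB x PA) (v ∧ memB x PB)) (sym oaT) (sym obT)) (eqGen x)

    mIn : ∀ {x l} → memB x l ≡ true → x ∈ l
    mIn {x} {l} e = memB-sound x l (subst T (sym e) tt)

    E1a : ∀ x → x ∈ P4 → x ∈ PA → x ∉ PB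
    E1a x x4 xA xB = bE1a (eqAB x) (memT x P4 x4) (memT x PA xA) (memT x PB xB)

    E1b : ∀ x → x ∈ P4 → x ∈ PA ⊎ x ∈ PB
    E1b x x4 with bcase (memB x PA)
    ... | inj₁ eA = inj₁ (mIn eA)
    ... | inj₂ eA = inj₂ (mIn (bE1b (eqAB x) (memT x P4 x4) eA))

    E2 : ∀ y → y ∉ P4 → y ∈ PA → y ∈ PB
    E2 y y4 yA = mIn (bE2 (eqAB y) (memB-false y P4 y4) (memT y PA yA))

    E2' : ∀ y → y ∉ P4 → y ∈ PB → y ∈ PA
    E2' y y4 yB = mIn (bE2' (eqAB y) (memB-false y P4 y4) (memT y PB yB))

    open SideRing PA PB P4 (paletteAt-distinct' (vB side₀₁)) (paletteAt-distinct' (vB cb)) (paletteAt-distinct' (vI interior₁₁)) (side-size side₀₁) (side-size cb) (interior-size interior₁₁) E1a E1b E2 E2' using (ring)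

    -- The weight W: count, at each vertex, the boundary edges (edges along the
    -- first/last row or column) whose colour lies in PA ∩ P4.  By the handshake
    -- it is even; but it is 0 inside, constant on corners, and by 'ring' it is
    -- 1 exactly at the a side vertices with palette PA — an odd total.
    ringRow ringCol : ℕ → Bool
    ringRow i = (i N.≡ᵇ 0) ∨ (i N.≡ᵇ suc (suc A))
    ringCol j = (j N.≡ᵇ 0) ∨ (j N.≡ᵇ suc (suc B))
    Tc : ℕ → Bool
    Tc c = memB c PA ∧ memB c P4
    hR vR : ℕ → ℕ → ℕ
    hR i j = b2n (ringRow i ∧ Tc (hColour i j))
    vR i j = b2n (ringCol j ∧ Tc (vColour i j))
    W : ℕ → ℕ → ℕ
    W = incidentSum hR vR
    gT : ℕ → ℕ
    gT c = b2n (Tc c)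

    Wpar : odd (cornerSum W + sideSum W + interiorSum W) ≡ false
    Wpar = trans (cong odd (sym (gridSum-regions W))) (handshake-even hR vR)

    -- Interior vertices meet no boundary edges.
    intW : ∀ i j → Interior i j → W i j ≡ 0
    intW _ _ (int i j p q) =
      cong₂ _+_ (cong₂ _+_ (trans (cong (λ v → if (suc (suc j) N.<ᵇ n) then v else 0) (hz (suc j))) (ifz (suc (suc j) N.<ᵇ n))) (hz j))
                (cong₂ _+_ (trans (cong (λ v → if (suc (suc i) N.<ᵇ m) then v else 0) (vz (suc i))) (ifz (suc (suc i) N.<ᵇ m))) (vz i))
      where
      hz : ∀ x → hR (suc i) x ≡ 0
      hz x rewrite ≡ᵇ-lt p = refl
      vz : ∀ x → vR x (suc j) ≡ 0
      vz x rewrite ≡ᵇ-lt q = refl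

    -- A side vertex: its two boundary colours r1, r2 and its third colour d,
    -- which is also a colour of the adjacent interior vertex.
    record BV (i j : ℕ) : Set where
      field
        r1 r2 d : ℕ
        m1 : r1 ∈ paletteAt i j
        m2 : r2 ∈ paletteAt i j
        md : d ∈ paletteAt i j
        n12 : r1 ≢ r2
        n1d : r1 ≢ d
        n2d : r2 ≢ d
        di dj : ℕ
        dint : Interior di dj
        dm : d ∈ paletteAt di dj
        wE : W i j ≡ gT r1 + gT r2

    bview : ∀ {i j} → Side i j → BV i j
    bview c@(top t p) = record
      { r1 = hColour 0 (suc t) ; r2 = hColour 0 t ; d = vColour 0 (suc t)
      ; m1 = port∈paletteAt {0} {suc t} R eR ; m2 = port∈paletteAt {0} {suc t} L refl ; md = port∈paletteAt {0} {suc t} D refl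
      ; n12 = ports-distinct' (vB c) R L (λ ()) eR refl ; n1d = ports-distinct' (vB c) R D (λ ()) eR refl ; n2d = ports-distinct' (vB c) L D (λ ()) refl refl
      ; di = 1 ; dj = suc t ; dint = int 0 t (s≤s z≤n) p ; dm = port∈paletteAt {1} {suc t} U refl
      ; wE = wE' }
      where
      eR : port R 0 (suc t) ≡ just (hColour 0 (suc t))
      eR = portR-yes 0 (suc t) (s≤s (s≤s p))
      wE' : W 0 (suc t) ≡ gT (hColour 0 (suc t)) + gT (hColour 0 t)
      wE' rewrite <ᵇ-true p | ≡ᵇ-lt p = NP.+-identityʳ _
    bview c@(bot t p) = record
      { r1 = hColour (suc (suc A)) (suc t) ; r2 = hColour (suc (suc A)) t ; d = vColour (suc A) (suc t)
      ; m1 = port∈paletteAt {suc (suc A)} {suc t} R eR ; m2 = port∈paletteAt {suc (suc A)} {suc t} L refl ; md = port∈paletteAt {suc (suc A)} {suc t} U refl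
      ; n12 = ports-distinct' (vB c) R L (λ ()) eR refl ; n1d = ports-distinct' (vB c) R U (λ ()) eR refl ; n2d = ports-distinct' (vB c) L U (λ ()) refl refl
      ; di = suc A ; dj = suc t ; dint = int A t (NP.n<1+n A) p ; dm = port∈paletteAt {suc A} {suc t} D (portD-yes (suc A) (suc t) (NP.n<1+n _))
      ; wE = wE' }
      where
      eR : port R (suc (suc A)) (suc t) ≡ just (hColour (suc (suc A)) (suc t))
      eR = portR-yes (suc (suc A)) (suc t) (s≤s (s≤s p))
      wE' : W (suc (suc A)) (suc t) ≡ gT (hColour (suc (suc A)) (suc t)) + gT (hColour (suc (suc A)) t)
      wE' rewrite <ᵇ-true p | ≡ᵇ-lt p | ProfileFacts.<ᵇ-irr A | ProfileFacts.≡ᵇ-refl A = NP.+-identityʳ _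
    bview c@(lft t p) = record
      { r1 = vColour (suc t) 0 ; r2 = vColour t 0 ; d = hColour (suc t) 0
      ; m1 = port∈paletteAt {suc t} {0} D eD ; m2 = port∈paletteAt {suc t} {0} U refl ; md = port∈paletteAt {suc t} {0} R refl
      ; n12 = ports-distinct' (vB c) D U (λ ()) eD refl ; n1d = ports-distinct' (vB c) D R (λ ()) eD refl ; n2d = ports-distinct' (vB c) U R (λ ()) refl refl
      ; di = suc t ; dj = 1 ; dint = int t 0 p (s≤s z≤n) ; dm = port∈paletteAt {suc t} {1} L refl
      ; wE = wE' }
      where
      eD : port D (suc t) 0 ≡ just (vColour (suc t) 0)
      eD = portD-yes (suc t) 0 (s≤s (s≤s p))
      wE' : W (suc t) 0 ≡ gT (vColour (suc t) 0) + gT (vColour t 0)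
      wE' rewrite <ᵇ-true p | ≡ᵇ-lt p = refl
    bview c@(rgt t p) = record
      { r1 = vColour (suc t) (suc (suc B)) ; r2 = vColour t (suc (suc B)) ; d = hColour (suc t) (suc B)
      ; m1 = port∈paletteAt {suc t} {suc (suc B)} D eD ; m2 = port∈paletteAt {suc t} {suc (suc B)} U refl ; md = port∈paletteAt {suc t} {suc (suc B)} L refl
      ; n12 = ports-distinct' (vB c) D U (λ ()) eD refl ; n1d = ports-distinct' (vB c) D L (λ ()) eD refl ; n2d = ports-distinct' (vB c) U L (λ ()) refl refl
      ; di = suc t ; dj = suc B ; dint = int t B p (NP.n<1+n B) ; dm = port∈paletteAt {suc t} {suc B} R (portR-yes (suc t) (suc B) (NP.n<1+n _))
      ; wE = wE' }
      where
      eD : port D (suc t) (suc (suc B)) ≡ just (vColour (suc t) (suc (suc B)))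
      eD = portD-yes (suc t) (suc (suc B)) (s≤s (s≤s p))
      wE' : W (suc t) (suc (suc B)) ≡ gT (vColour (suc t) (suc (suc B))) + gT (vColour t (suc (suc B)))
      wE' rewrite <ᵇ-true p | ≡ᵇ-lt p | ProfileFacts.<ᵇ-irr B | ProfileFacts.≡ᵇ-refl B = refl

    tcB : ∀ r → r ∈ PB → Tc r ≡ false
    tcB r rB with bcase (memB r P4)
    ... | inj₂ e4 = trans (cong (memB r PA ∧_) e4) (∧-zeroʳ (memB r PA))
    ... | inj₁ e4 with bcase (memB r PA)
    ... | inj₂ eA = cong (_∧ memB r P4) eA
    ... | inj₁ eA = ⊥-elim (E1a r (mIn e4) (mIn eA) rB)

    bndW : ∀ i j → Side i j → W i j ≡ isL ℓA i j
    bndW i j c with two i j c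
    ... | inj₁ eA = trans (BV.wE v) (trans val (sym (isL-yes {ℓA} {i} {j} eA)))
      where
      v = bview c
      open BV v
      sA : ∀ z → z ∈ paletteAt i j → z ∈ PA
      sA = sameLabel⇒⊆' (vB c) (vB side₀₁) eA
      d4 : d ∈ P4
      d4 = sameLabel⇒⊆' (vI dint) (vI interior₁₁) (IU _ _ dint) d dm
      val : gT r1 + gT r2 ≡ 1
      val = gval (memT r1 PA (sA r1 m1)) (memT r2 PA (sA r2 m2)) (conv (ring n12 n1d n2d (sA r1 m1) (sA r2 m2) (sA d md) d4))
        where
        conv : (r1 ∈ P4 × r2 ∉ P4) ⊎ (r1 ∉ P4 × r2 ∈ P4) →
               (memB r1 P4 ≡ true × memB r2 P4 ≡ false) ⊎ (memB r1 P4 ≡ false × memB r2 P4 ≡ true)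
        conv (inj₁ (h1 , h2)) = inj₁ (memT r1 P4 h1 , memB-false r2 P4 h2)
        conv (inj₂ (h1 , h2)) = inj₂ (memB-false r1 P4 h1 , memT r2 P4 h2)
    ... | inj₂ eB = trans (BV.wE v) (trans (cong₂ (λ u w → b2n u + b2n w) (tcB r1 (sB r1 m1)) (tcB r2 (sB r2 m2)))
                      (sym (isL-no {ℓA} {i} {j} (λ e → nAB (trans (sym e) eB)))))
      where
      v = bview c
      open BV v
      sB : ∀ z → z ∈ paletteAt i j → z ∈ PB
      sB = sameLabel⇒⊆' (vB c) (vB cb) eB

    corW : ∀ i j → Corner i j → W i j ≡ incidentSum (λ i j → gT (hColour i j)) (λ i j → gT (vColour i j)) i j
    corW _ _ c00 = refl
    corW _ _ c0n rewrite ProfileFacts.≡ᵇ-refl B = refl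
    corW _ _ cm0 rewrite ProfileFacts.≡ᵇ-refl A = refl
    corW _ _ cmn rewrite ProfileFacts.≡ᵇ-refl A | ProfileFacts.≡ᵇ-refl B = refl

    -- At a corner both edges are boundary edges, so W only depends on the palette.
    corVal : ∀ i j → Corner i j → W i j ≡ W 0 0
    corVal i j c = trans (corW i j c) (trans (sym (sum-palette gT i j))
                    (trans (sameSum gT (paletteAt i j) (paletteAt 0 0) (paletteAt-distinct' (vC c)) (paletteAt-distinct' (vC c00))
                              (sameLabel⇒⊆' (vC c) (vC c00) (CU i j c)) (sameLabel⇒⊆' (vC c00) (vC c) (sym (CU i j c))))
                           (trans (sum-palette gT 0 0) (sym (corW 0 0 c00)))))

    -- The total of W is both even and odd.
    contra : ⊥
    contra = case trans (sym totalOdd) Wpar of λ ()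
      where
      open ≡-Reasoning
      cornersEven : odd (cornerSum W) ≡ false
      cornersEven = trans (cong odd (cornerSum-cong W (λ _ _ → W 0 0) corVal)) (cornerSum-const-even (W 0 0))
      sidesA : sideSum W ≡ a
      sidesA = sideSum-cong W (isL ℓA) bndW
      interiorZero : interiorSum W ≡ 0
      interiorZero = trans (interiorSum-cong W (λ _ _ → 0) intW)
        (trans (sum-cong MI (λ _ _ → trans (sum-const NI 0) (NP.*-zeroʳ NI))) (trans (sum-const MI 0) (NP.*-zeroʳ MI)))
      totalOdd : odd (cornerSum W + sideSum W + interiorSum W) ≡ true
      totalOdd = begin
        odd (cornerSum W + sideSum W + interiorSum W)
          ≡⟨ par3 (cornerSum W) (sideSum W) (interiorSum W) ⟩
        xor (xor (odd (cornerSum W)) (odd (sideSum W))) (odd (interiorSum W))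
          ≡⟨ cong₂ (λ u v → xor (xor u v) (odd (interiorSum W))) cornersEven (cong odd sidesA) ⟩
        xor (odd a) (odd (interiorSum W))
          ≡⟨ cong (λ u → xor (odd a) (odd u)) interiorZero ⟩
        xor (odd a) false
          ≡⟨ cong (λ u → xor u false) oaT ⟩
        true ∎

  open CountLabels using (five)
  open import Relation.Nullary.Decidable using (_⊎-dec_)

  dq : ∀ ℓ i j → Dec (labelAt i j ≡ ℓ)
  dq ℓ i j = labelAt i j FP.≟ ℓ

  -- Decide uniformity of sides, interior and corners; every branch either
  -- exhibits five pairwise different labels or is one of the three cases above.
  at-least-five : 5 ≤ k
  at-least-five with decideSides (λ i j → labelAt i j ≡ labelAt 0 1) (dq (labelAt 0 1))
  at-least-five | inj₁ BU with decideInterior (λ i j → labelAt i j ≡ labelAt 1 1) (dq (labelAt 1 1))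
  at-least-five | inj₁ BU | inj₁ IU = ⊥-elim (uniform-regions-impossible BU IU)
  at-least-five | inj₁ BU | inj₂ (iw , jw , cw , nw) with decideCorners (λ i j → labelAt i j ≡ labelAt 0 0) (dq (labelAt 0 0))
  at-least-five | inj₁ BU | inj₂ (iw , jw , cw , nw) | inj₂ (ic , jc , cc , nc) =
    five (≢-sym nc) (corner≢side c00 side₀₁) (corner≢interior c00 interior₁₁) (corner≢interior c00 cw) (corner≢side cc side₀₁) (corner≢interior cc interior₁₁) (corner≢interior cc cw) (side≢interior side₀₁ interior₁₁) (side≢interior side₀₁ cw) (≢-sym nw)
  at-least-five | inj₁ BU | inj₂ (iw , jw , cw , nw) | inj₁ CU
    with decideInterior (λ i j → labelAt i j ≡ labelAt 1 1 ⊎ labelAt i j ≡ labelAt iw jw) (λ i j → dq (labelAt 1 1) i j ⊎-dec dq (labelAt iw jw) i j)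
  ... | inj₁ twoI = ⊥-elim (two-interior-palettes-impossible BU CU iw jw cw nw twoI)
  ... | inj₂ (i2 , j2 , c2 , n2) =
    five (corner≢side c00 side₀₁) (corner≢interior c00 interior₁₁) (corner≢interior c00 cw) (corner≢interior c00 c2) (side≢interior side₀₁ interior₁₁) (side≢interior side₀₁ cw) (side≢interior side₀₁ c2)
         (≢-sym nw) (λ e → n2 (inj₁ (sym e))) (λ e → n2 (inj₂ (sym e)))
  at-least-five | inj₂ (ib , jb , cb , nb) with decideInterior (λ i j → labelAt i j ≡ labelAt 1 1) (dq (labelAt 1 1))
  at-least-five | inj₂ (ib , jb , cb , nb) | inj₂ (iw , jw , cw , nw) =
    five (corner≢side c00 side₀₁) (corner≢side c00 cb) (corner≢interior c00 interior₁₁) (corner≢interior c00 cw) (≢-sym nb) (side≢interior side₀₁ interior₁₁) (side≢interior side₀₁ cw) (side≢interior cb interior₁₁) (side≢interior cb cw) (≢-sym nw)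
  at-least-five | inj₂ (ib , jb , cb , nb) | inj₁ IU with decideCorners (λ i j → labelAt i j ≡ labelAt 0 0) (dq (labelAt 0 0))
  at-least-five | inj₂ (ib , jb , cb , nb) | inj₁ IU | inj₂ (ic , jc , cc , nc) =
    five (≢-sym nc) (corner≢side c00 side₀₁) (corner≢side c00 cb) (corner≢interior c00 interior₁₁) (corner≢side cc side₀₁) (corner≢side cc cb) (corner≢interior cc interior₁₁) (≢-sym nb) (side≢interior side₀₁ interior₁₁) (side≢interior cb interior₁₁)
  at-least-five | inj₂ (ib , jb , cb , nb) | inj₁ IU | inj₁ CU
    with decideSides (λ i j → labelAt i j ≡ labelAt 0 1 ⊎ labelAt i j ≡ labelAt ib jb) (λ i j → dq (labelAt 0 1) i j ⊎-dec dq (labelAt ib jb) i j)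
  ... | inj₁ twoB = ⊥-elim (TwoSidePalettes.contra IU CU ib jb cb nb twoB)
  ... | inj₂ (i2 , j2 , c2 , n2) =
    five (corner≢side c00 side₀₁) (corner≢side c00 cb) (corner≢side c00 c2) (corner≢interior c00 interior₁₁) (≢-sym nb) (λ e → n2 (inj₁ (sym e))) (side≢interior side₀₁ interior₁₁)
         (λ e → n2 (inj₂ (sym e))) (side≢interior cb interior₁₁) (side≢interior c2 interior₁₁)

module Parity where
  open Profiles using (odd)
  open FiniteSums using (odd-*)
  open import Data.Nat.Divisibility using (divides; ∣m⇒∣m*n; ∣n⇒∣m*n)
  open import Data.Bool.Properties using (not-involutive; ∧-zeroʳ)

  ∣⇒even : ∀ {k} → 2 ∣ k → odd k ≡ false
  ∣⇒even (divides q refl) rewrite odd-* q 2 = ∧-zeroʳ (odd q)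

  even⇒∣ : ∀ k → odd k ≡ false → 2 ∣ k
  even⇒∣ zero _ = divides 0 refl
  even⇒∣ (suc (suc k)) e with even⇒∣ k (trans (sym (not-involutive (odd k))) e)
  ... | divides q eq = divides (suc q) (cong (λ z → suc (suc z)) eq)

  ∣-product : ∀ m n → 2 ∣ m * n → odd m ≡ false ⊎ odd n ≡ false
  ∣-product m n d with odd m in e
  ... | false = inj₁ refl
  ... | true = inj₂ (trans (sym (cong (_∧ odd n) e)) (trans (sym (odd-* m n)) (∣⇒even d)))

  ∤-product : ∀ m n → ¬ (2 ∣ m * n) → odd m ≡ true × odd n ≡ true
  ∤-product m n nd = oddFactor m (λ d → nd (∣m⇒∣m*n n d)) , oddFactor n (λ d → nd (∣n⇒∣m*n m d))
    where
    oddFactor : ∀ k → ¬ (2 ∣ k) → odd k ≡ true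
    oddFactor k nk with odd k in e
    ... | true = refl
    ... | false = ⊥-elim (nk (even⇒∣ k e))

  odd-2+ : ∀ k → odd (suc (suc k)) ≡ odd k
  odd-2+ k = not-involutive (odd k)

palette-index-transpose : ∀ {m n k} → PaletteIndex n m k → PaletteIndex m n k
palette-index-transpose (upper , lower) =
  transpose-colouring upper ,
  λ φ pr k' at → lower (Transpose.ψ φ) (Transpose.properT φ pr) k' (Transpose.atT φ at)

-- Every vertex of G(2,2) is a corner with palette {0,1}.
palette-index-2×2 : PaletteIndex 2 2 1
palette-index-2×2 = (proj₁ C , proj₁ (proj₂ C) , relabel-palettes (proj₂ (proj₂ C)) (λ _ → F.zero) sameLabel) , atLeastOne
  where
  C = EvenColouring.colouring 2 2 refl (s≤s (s≤s z≤n)) (s≤s (s≤s z≤n))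
  label = proj₁ (proj₂ (proj₂ C))
  allCorners : ∀ x → label x ≡ F.zero
  allCorners (F.zero , F.zero) = refl
  allCorners (F.zero , F.suc F.zero) = refl
  allCorners (F.suc F.zero , F.zero) = refl
  allCorners (F.suc F.zero , F.suc F.zero) = refl
  sameLabel : ∀ x y → F.zero ≡ F.zero → label x ≡ label y
  sameLabel x y _ = trans (allCorners x) (sym (allCorners y))
  atLeastOne : (φ : EdgeColouring 2 2) → Proper φ → (k' : ℕ) → AtMostPalettes φ k' → 1 ≤ k'
  atLeastOne φ pr (suc k') at = s≤s z≤n
  atLeastOne φ pr zero (f , _) with f (F.zero , F.zero)
  ... | ()

-- G(2,N+3): the even colouring has no interior vertices, so its corner and
-- side labels give two palettes; corners (2 neighbours) and sides (3) differ.
palette-index-2×n : ∀ N → PaletteIndex 2 (suc (suc (suc N))) 2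
palette-index-2×n N =
  (proj₁ C , proj₁ (proj₂ C) , relabel-palettes (proj₂ (proj₂ C)) squash (λ x y e → squash-injective _ _ (noInterior x) (noInterior y) e)) ,
  atLeastTwo
  where
  open CountLabels using (two)
  C = EvenColouring.colouring 2 (suc (suc (suc N))) refl (s≤s (s≤s z≤n)) (s≤s (s≤s z≤n))
  interior : Fin 3
  interior = F.suc (F.suc F.zero)
  squash : Fin 3 → Fin 2
  squash F.zero = F.zero
  squash (F.suc F.zero) = F.suc F.zero
  squash (F.suc (F.suc F.zero)) = F.zero
  squash-injective : ∀ a b → a ≢ interior → b ≢ interior → squash a ≡ squash b → a ≡ b
  squash-injective F.zero F.zero _ _ _ = refl
  squash-injective (F.suc F.zero) (F.suc F.zero) _ _ _ = refl
  squash-injective (F.suc (F.suc F.zero)) _ na _ _ = ⊥-elim (na refl)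
  squash-injective _ (F.suc (F.suc F.zero)) _ nb _ = ⊥-elim (nb refl)
  noInterior : ∀ x → proj₁ (proj₂ (proj₂ C)) x ≢ interior
  noInterior (F.zero , b) = EvenColouring.codeTy 2 (suc (suc (suc N))) refl (s≤s (s≤s z≤n)) (s≤s (s≤s z≤n)) 0 (toℕ b) refl
  noInterior (F.suc F.zero , b) = EvenColouring.codeTy 2 (suc (suc (suc N))) refl (s≤s (s≤s z≤n)) (s≤s (s≤s z≤n)) 1 (toℕ b) refl
  atLeastTwo : (φ : EdgeColouring 2 (suc (suc (suc N)))) → Proper φ → (k' : ℕ) → AtMostPalettes φ k' → 2 ≤ k'
  atLeastTwo φ pr k' (f , fOK) =
    two (smaller-palette⇒other-label (pos 0 0 (s≤s z≤n) (s≤s z≤n)) (pos 0 1 (s≤s z≤n) (s≤s (s≤s z≤n))) (s≤s (s≤s (s≤s z≤n))))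
    where open PaletteLists 1 (suc (suc N)) φ pr f fOK

at-least-three : ∀ A B (φ : EdgeColouring (suc (suc (suc A))) (suc (suc (suc B)))) → Proper φ →
  (k' : ℕ) → AtMostPalettes φ k' → 3 ≤ k'
at-least-three A B φ pr k' (f , fOK) =
  three (corner≢side c00 side) (corner≢interior c00 interior) (side≢interior side interior)
  where
  open GridRegions A B φ pr f fOK
  open CountLabels using (three)
  side = top 0 (s≤s z≤n)
  interior = int 0 0 (s≤s z≤n) (s≤s z≤n)

palette-index-even : ∀ A B → Profiles.odd (suc (suc (suc A))) ≡ false →
  PaletteIndex (suc (suc (suc A))) (suc (suc (suc B))) 3
palette-index-even A B ev =
  EvenColouring.colouring (suc (suc (suc A))) (suc (suc (suc B))) ev (s≤s (s≤s z≤n)) (s≤s (s≤s z≤n)) ,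
  at-least-three A B

palette-index-odd : ∀ A B → Profiles.odd (suc (suc (suc A))) ≡ true → Profiles.odd (suc (suc (suc B))) ≡ true →
  PaletteIndex (suc (suc (suc A))) (suc (suc (suc B))) 5
palette-index-odd A B oA oB =
  OddColouring.colouring (suc (suc (suc A))) (suc (suc (suc B))) oA oB (s≤s (s≤s (s≤s z≤n))) (s≤s (s≤s (s≤s z≤n))) ,
  λ φ pr k' (f , fOK) → AtLeastFive.at-least-five A B φ pr f fOK
    (trans (sym (Parity.odd-2+ (suc A))) oA) (trans (sym (Parity.odd-2+ (suc B))) oB)

case-2×2 : ∀ m n → (m ≡ 2 × n ≡ 2) → PaletteIndex m n 1
case-2×2 .2 .2 (refl , refl) = palette-index-2×2

case-min-2 : ∀ m n → (m ⊓ n ≡ 2 × 3 ≤ m ⊔ n) → PaletteIndex m n 2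
case-min-2 m n (e , h3) with NP.≤-total m n
... | inj₁ m≤n = row (trans (sym (NP.m≤n⇒m⊓n≡m m≤n)) e) (subst (3 ≤_) (NP.m≤n⇒m⊔n≡n m≤n) h3)
  where
  row : ∀ {m n} → m ≡ 2 → 3 ≤ n → PaletteIndex m n 2
  row refl (s≤s (s≤s (s≤s {n = N} z≤n))) = palette-index-2×n N
... | inj₂ n≤m = column (trans (sym (NP.m≥n⇒m⊓n≡n n≤m)) e) (subst (3 ≤_) (NP.m≥n⇒m⊔n≡m n≤m) h3)
  where
  column : ∀ {m n} → n ≡ 2 → 3 ≤ m → PaletteIndex m n 2
  column refl (s≤s (s≤s (s≤s {n = M} z≤n))) = palette-index-transpose (palette-index-2×n M)

case-even : ∀ m n → (3 ≤ m × 3 ≤ n × 2 ∣ m * n) → PaletteIndex m n 3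
case-even _ _ (s≤s (s≤s (s≤s {n = A} z≤n)) , s≤s (s≤s (s≤s {n = B} z≤n)) , d) with Parity.∣-product (suc (suc (suc A))) (suc (suc (suc B))) d
... | inj₁ evenM = palette-index-even A B evenM
... | inj₂ evenN = palette-index-transpose (palette-index-even B A evenN)

case-odd : ∀ m n → (3 ≤ m × 3 ≤ n × ¬ (2 ∣ m * n)) → PaletteIndex m n 5
case-odd _ _ (s≤s (s≤s (s≤s {n = A} z≤n)) , s≤s (s≤s (s≤s {n = B} z≤n)) , nd) =
  let (oddM , oddN) = Parity.∤-product (suc (suc (suc A))) (suc (suc (suc B))) nd
  in palette-index-odd A B oddM oddN

theorem3p6 : (m n : ℕ) → 2 ≤ m → 2 ≤ n →
    ((m ≡ 2 × n ≡ 2) → PaletteIndex m n 1)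
    × ((m ⊓ n ≡ 2 × 3 ≤ m ⊔ n) → PaletteIndex m n 2)
    × ((3 ≤ m × 3 ≤ n × 2 ∣ m * n) → PaletteIndex m n 3)
    × ((3 ≤ m × 3 ≤ n × ¬ (2 ∣ m * n)) → PaletteIndex m n 5)
theorem3p6 m n _ _ = case-2×2 m n , case-min-2 m n , case-even m n , case-odd m n
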